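{- Let $p$ be a prime with $p\equiv1$ or $5\pmod 6$. If $p\equiv 1\pmod 6$, let $S_p=\{0,-1,\zeta,\zeta^{ -1}\}\subset\mathbb F_p$ where $\zeta$ is a primitive cube root of unity in $\mathbb F_p$; if $p\equiv 5\pmod 6$, let $S_p=\{0,-1\}$. If $p$ is not a Wieferich prime, the set of roots of $f_p$ in $\mathbb F_p$ is the union of $S_p$ with zero or more pairwise disjoint six-packs (disjoint from $S_p$). If $p$ is a Wieferich prime, the set of roots of $f_p$ in $\mathbb F_p$ consists of $S_p$, together with $\{1,-2,-2^{ -1}\}$, together with zero or more pairwise disjoint six-packs.
   Context: For a prime $p$, $f_p(x)=\frac{(x+1)^p-x^p-1}{p}\in\mathbb Z[x]$, and roots of $f_p$ are taken modulo $p$ (in $\mathbb F_p$). A six-pack is a set of six distinct elements of $\mathbb F_p$ of the form $\{x,-x-1,-\frac1{x+1},-\frac{x}{x+1},-\frac{x+1}{x},\frac1x\}$, all of which are roots of $f_p$. A Wieferich prime is a prime $p$ with $p^2\mid 2^p-2$. -}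

module Defs where

open import Data.Nat using (ℕ; zero; suc; _+_; _*_; _∸_; _^_; _<_)
open import Data.Nat.DivMod using (_/_)
import Data.Nat.Divisibility as ℕD
open import Data.Integer as ℤ using (ℤ; +_; -_; _-_)
import Data.Integer.Divisibility as ℤD
open import Data.Fin using (Fin)
open import Data.Vec using (Vec; []; _∷_; lookup)
open import Data.Vec.Membership.Propositional using (_∈_)
open import Data.List using (List)
open import Data.List.Relation.Unary.All using (All)
open import Data.List.Relation.Unary.Any using (Any)
open import Data.List.Relation.Unary.AllPairs using (AllPairs)
open import Data.Product using (Σ; _×_)
open import Data.Sum using (_⊎_)
open import Relation.Binary.PropositionalEquality using (_≡_)
open import Relation.Nullary using (¬_)

infix 4 _≋_[_]
_≋_[_] : ℤ → ℤ → ℕ → Set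
a ≋ b [ p ] = (+ p) ℤD.∣ (a - b)

-- f_p evaluated at a natural number x (an integer representative of an
-- element of F_p):  f_p(x) = ((x+1)^p - x^p - 1) / p.
-- For x ∈ ℕ the numerator is ≥ 0, so truncated subtraction is exact,
-- and for p prime the division is exact.
fval : ℕ → ℕ → ℕ
fval zero    x = 0
fval p@(suc _) x = ((x + 1) ^ p ∸ x ^ p ∸ 1) / p

IsRoot : ℕ → ℕ → Set
IsRoot p x = p ℕD.∣ fval p x

-- Elements of F_p are represented by naturals x < p.
-- A six-pack given as the vector
--   [x , -x-1 , -1/(x+1) , -x/(x+1) , -(x+1)/x , 1/x]
-- (fractions in F_p, expressed by their defining congruences), with
-- all six entries distinct residues in [0,p) and all roots of f_p.
SixPack : ℕ → Vec ℕ 6 → Set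
SixPack p v@(a ∷ b ∷ c ∷ d ∷ e ∷ f ∷ []) =
  ((i : Fin 6) → lookup v i < p)
  × ((i j : Fin 6) → lookup v i ≡ lookup v j → i ≡ j)
  × ((+ b) ≋ (- (+ a) - + 1) [ p ])
  × ((+ c) ℤ.* (+ a ℤ.+ + 1) ≋ - + 1 [ p ])
  × ((+ d) ℤ.* (+ a ℤ.+ + 1) ≋ - (+ a) [ p ])
  × ((+ e) ℤ.* (+ a) ≋ - (+ a ℤ.+ + 1) [ p ])
  × ((+ f) ℤ.* (+ a) ≋ + 1 [ p ])
  × ((i : Fin 6) → IsRoot p (lookup v i))

Disjoint : Vec ℕ 6 → Vec ℕ 6 → Set
Disjoint v w = ∀ y → y ∈ v → y ∈ w → ⊥'
  where open import Data.Empty renaming (⊥ to ⊥')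

Wieferich : ℕ → Set
Wieferich p = (p * p) ℕD.∣ (2 ^ p ∸ 2)

InW : ℕ → ℕ → Set
InW p y = ((+ y) ≋ + 1 [ p ]) ⊎ ((+ y) ≋ - + 2 [ p ]) ⊎ ((+ 2) ℤ.* (+ y) ≋ - + 1 [ p ])

InPacks : List (Vec ℕ 6) → ℕ → Set
InPacks ps y = Any (λ v → y ∈ v) ps

NonWiefShape : ℕ → (ℕ → Set) → Set
NonWiefShape p S = Σ (List (Vec ℕ 6)) λ ps →
    All (SixPack p) ps
  × AllPairs Disjoint ps
  × All (λ v → ∀ y → y ∈ v → ¬ S y) ps
  × (∀ y → y < p → (IsRoot p y → S y ⊎ InPacks ps y)
                  × (S y ⊎ InPacks ps y → IsRoot p y))

WiefShape : ℕ → (ℕ → Set) → Set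
WiefShape p S = Σ (List (Vec ℕ 6)) λ ps →
    All (SixPack p) ps
  × AllPairs Disjoint ps
  × (∀ y → y < p → (IsRoot p y → S y ⊎ InW p y ⊎ InPacks ps y)
                  × (S y ⊎ InW p y ⊎ InPacks ps y → IsRoot p y))

RootShape : ℕ → (ℕ → Set) → Set
RootShape p S = (¬ Wieferich p → NonWiefShape p S) × (Wieferich p → WiefShape p S)

-- Write N x = (x+1)ᵖ - xᵖ - 1 = p · f_p(x); x is a root of f_p modulo p iff p² ∣ N x. Since
-- a ≡ b (mod p) implies aᵖ ≡ bᵖ (mod p²), this only depends on x mod p, and as p is odd
-- N(-x-1) = N(x) and yᵖ N(x) ≡ N(y) (mod p²) when xy ≡ 1. So x ↦ -x-1 and x ↦ 1/x generate an
-- action of S₃ on the roots, whose orbits {x, -x-1, -1/(x+1), -x/(x+1), -(x+1)/x, 1/x} are the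
-- six-packs. For x ≠ 0, -1 two entries of the pack of x coincide only if x is a primitive cube
-- root of unity or one of 1, -2, -1/2. The values 0 and -1 are always roots. A primitive cube root of unity
-- exists iff p ≡ 1 (mod 6), and then it is a root. Finally 1 is a root iff p² ∣ 2ᵖ - 2, i.e. iff
-- p is a Wieferich prime, and then so are -2 and -1/2. The remaining roots split into disjoint
-- six-packs, one for each orbit, indexed by the smallest residue in it.

module Submission where

open import Data.Nat as ℕ using (ℕ; suc)
open import Data.Nat.Primality using (Prime)
open import Relation.Binary.PropositionalEquality using (_≡_)

module BinomialModPrime where
  open import Algebra.Definitions.RawMonoid as RawMonoid using ()
  import Algebra.Properties.CommutativeSemiring.Binomial as Binomial
  open import Data.Empty using (⊥-elim)
  open import Data.Fin as Fin using (Fin; toℕ; inject₁; fromℕ)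
  open import Data.Fin.Properties using (toℕ-inject₁; toℕ-fromℕ; toℕ<n)
  open import Data.Nat
  open import Data.Nat.Combinatorics using (_C_; nCn≡1; nCk≡n!/k![n-k]!; k![n∸k]!∣n!)
  open import Data.Nat.DivMod using (m/n*n≡m)
  open import Data.Nat.Divisibility
  open import Data.Nat.Primality using (Prime; euclidsLemma; ¬prime[1])
  open import Data.Nat.Properties
  open import Data.Product using (∃-syntax; _×_; _,_)
  open import Data.Sum using (inj₁; inj₂)
  open import Data.Vec.Functional using (Vector; init; tail)
  open import Function using (_∘_)
  open import Relation.Binary.PropositionalEquality
  open import Relation.Nullary using (¬_)
  open import Algebra.Properties.Monoid.Sum +-0-monoid using (sum; sum-init-last)

  private
    module B = Binomial +-*-commutativeSemiring
    module Mult = RawMonoid +-0-rawMonoid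
    module Pow = RawMonoid *-1-rawMonoid

    ×≡* : ∀ m x → m Mult.× x ≡ m * x
    ×≡* zero    x = refl
    ×≡* (suc m) x = cong (x +_) (×≡* m x)

    ^≡^ : ∀ x m → m Pow.× x ≡ x ^ m
    ^≡^ x zero    = refl
    ^≡^ x (suc m) = cong (x *_) (^≡^ x m)

  ∣-sum : ∀ {d n} (t : Vector ℕ n) → (∀ i → d ∣ t i) → d ∣ sum t
  ∣-sum {n = zero}  t d∣t = _ ∣0
  ∣-sum {n = suc n} t d∣t = ∣m∣n⇒∣m+n (d∣t Fin.zero) (∣-sum (tail t) (d∣t ∘ Fin.suc))

  prime∤1 : ∀ {p} → Prime p → ¬ p ∣ 1
  prime∤1 pr p∣1 = ¬prime[1] (subst Prime (∣1⇒≡1 p∣1) pr)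

  prime∤! : ∀ {p m} → Prime p → m < p → ¬ p ∣ m !
  prime∤! {m = zero}  pr _   = prime∤1 pr
  prime∤! {m = suc m} pr m<p p∣m! with euclidsLemma (suc m) (m !) pr p∣m!
  ... | inj₁ p∣1+m = <⇒≱ m<p (∣⇒≤ p∣1+m)
  ... | inj₂ p∣m!  = prime∤! pr (<-trans (n<1+n m) m<p) p∣m!

  prime∣pCk : ∀ {p k} → Prime p → 0 < k → k < p → p ∣ p C k
  prime∣pCk {p@(suc m)} {k} pr 0<k k<p
    with euclidsLemma (p C k) (k ! * (p ∸ k) !) pr (subst (p ∣_) (sym C*k!*[p∸k]!≡p!) (m∣m*n (m !)))
    where
    instance
      k!*[p∸k]!≢0 : NonZero (k ! * (p ∸ k) !)
      k!*[p∸k]!≢0 = k !* (p ∸ k) !≢0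
    C*k!*[p∸k]!≡p! : (p C k) * (k ! * (p ∸ k) !) ≡ p !
    C*k!*[p∸k]!≡p! = trans (cong (_* (k ! * (p ∸ k) !)) (nCk≡n!/k![n-k]! (<⇒≤ k<p)))
                           (m/n*n≡m (k![n∸k]!∣n! (<⇒≤ k<p)))
  ... | inj₁ p∣C = p∣C
  ... | inj₂ p∣k!*[p∸k]! with euclidsLemma (k !) ((p ∸ k) !) pr p∣k!*[p∸k]!
  ...   | inj₁ p∣k!     = ⊥-elim (prime∤! pr k<p p∣k!)
  ...   | inj₂ p∣[p∸k]! = ⊥-elim (prime∤! pr (∸-monoʳ-< 0<k (<⇒≤ k<p)) p∣[p∸k]!)

  binomialTerm≡ : ∀ n x k → B.binomialTerm x 1 n k ≡ (n C toℕ k) * x ^ toℕ k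
  binomialTerm≡ n x k = begin
    B.binomialTerm x 1 n k                               ≡⟨ ×≡* (n C toℕ k) _ ⟩
    (n C toℕ k) * (toℕ k Pow.× x * (n ∸ toℕ k) Pow.× 1)  ≡⟨ cong ((n C toℕ k) *_) (cong₂ _*_ (^≡^ x (toℕ k)) 1ⁿ≡1) ⟩
    (n C toℕ k) * (x ^ toℕ k * 1)                        ≡⟨ cong ((n C toℕ k) *_) (*-identityʳ _) ⟩
    (n C toℕ k) * x ^ toℕ k                              ∎
    where
    open ≡-Reasoning
    1ⁿ≡1 : (n ∸ toℕ k) Pow.× 1 ≡ 1
    1ⁿ≡1 = trans (^≡^ 1 (n ∸ toℕ k)) (^-zeroˡ (n ∸ toℕ k))

  freshmansDream : ∀ {p} → Prime p → ∀ x → ∃[ M ] (x + 1) ^ p ≡ x ^ p + (1 + p * M)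
  freshmansDream {p@(suc m)} pr x = quotient p∣middle , (begin
    (x + 1) ^ p                                          ≡⟨ binomialTheorem ⟩
    t Fin.zero + sum (tail t)                            ≡⟨ cong (t Fin.zero +_) (sum-init-last (tail t)) ⟩
    t Fin.zero + (sum (init (tail t)) + t (fromℕ p))     ≡⟨ cong₂ (λ a b → a + (sum (init (tail t)) + b)) first≡1 last≡xᵖ ⟩
    1 + (sum (init (tail t)) + x ^ p)                    ≡⟨ cong (λ s → 1 + (s + x ^ p)) (m∣n⇒n≡m*quotient p∣middle) ⟩
    1 + (p * quotient p∣middle + x ^ p)                  ≡⟨ rearrange 1 (p * quotient p∣middle) (x ^ p) ⟩
    x ^ p + (1 + p * quotient p∣middle)                  ∎)
    where
    open ≡-Reasoning
    t : Vector ℕ (suc p)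
    t = B.binomialTerm x 1 p
    binomialTheorem : (x + 1) ^ p ≡ sum t
    binomialTheorem = trans (sym (^≡^ (x + 1) p)) (B.theorem p x 1)
    first≡1 : t Fin.zero ≡ 1
    first≡1 = binomialTerm≡ p x Fin.zero
    last≡xᵖ : t (fromℕ p) ≡ x ^ p
    last≡xᵖ = begin
      t (fromℕ p)                              ≡⟨ binomialTerm≡ p x (fromℕ p) ⟩
      (p C toℕ (fromℕ p)) * x ^ toℕ (fromℕ p)  ≡⟨ cong (λ k → (p C k) * x ^ k) (toℕ-fromℕ p) ⟩
      (p C p) * x ^ p                          ≡⟨ cong (_* x ^ p) (nCn≡1 p) ⟩
      1 * x ^ p                                ≡⟨ *-identityˡ (x ^ p) ⟩
      x ^ p                                    ∎
    p∣middle : p ∣ sum (init (tail t))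
    p∣middle = ∣-sum _ λ i → subst (p ∣_) (sym (binomialTerm≡ p x (Fin.suc (inject₁ i))))
      (∣m⇒∣m*n (x ^ suc (toℕ (inject₁ i)))
        (prime∣pCk pr (s≤s z≤n) (s≤s (subst (_< m) (sym (toℕ-inject₁ i)) (toℕ<n i)))))
    rearrange : ∀ a b c → a + (b + c) ≡ c + (a + b)
    rearrange = solve-∀
      where open import Data.Nat.Tactic.RingSolver

module VecMinimum where
  open import Data.List.Extrema.Nat as Extrema using ()
  import Data.List.Relation.Unary.All as All
  open import Data.Nat using (ℕ; suc; _≤_)
  open import Data.Product using (∃-syntax; _×_; _,_)
  open import Data.Sum using ([_,_]′)
  open import Data.Vec as Vec using (Vec; _∷_)
  open import Data.Vec.Membership.Propositional using (_∈_)
  open import Data.Vec.Membership.Propositional.Properties using (∈-toList⁺; ∈-toList⁻)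
  open import Data.Vec.Relation.Unary.Any using (here; there)
  open import Function using (id; _∘_)
  open import Relation.Binary.PropositionalEquality using (refl)

  abstract
    minimum : ∀ {k} (xs : Vec ℕ (suc k)) → ∃[ m ] m ∈ xs × (∀ {w} → w ∈ xs → m ≤ w)
    minimum (x ∷ xs) = Extrema.min x (Vec.toList xs)
      , [ (λ m≡x → here m≡x) , there ∘ ∈-toList⁻ ]′ (Extrema.argmin-sel id x (Vec.toList xs))
      , λ { (here refl) → Extrema.min≤⊤ x (Vec.toList xs)
          ; (there w∈xs) → All.lookup (Extrema.min≤xs x (Vec.toList xs)) (∈-toList⁺ w∈xs) }


module IntegerPowers where
  open import Data.Integer using (ℤ; +_; -_; 0ℤ; 1ℤ; _+_; _-_; _*_; _^_)
  import Data.Integer.Properties as ℤ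
  open import Data.Integer.Divisibility.Signed using (_∣_; divides; ∣m∣n⇒∣m+n; ∣n⇒∣m*n)
  open import Data.Integer.Tactic.RingSolver
  open import Data.Nat as ℕ using (ℕ; zero; suc)
  open import Relation.Binary.PropositionalEquality

  ∣-lincomb₁ : ∀ {m e₁ e} c₁ → m ∣ e₁ → e ≡ c₁ * e₁ → m ∣ e
  ∣-lincomb₁ {m} c₁ d₁ e≡ = subst (m ∣_) (sym e≡) (∣n⇒∣m*n c₁ d₁)

  ∣-lincomb₂ : ∀ {m e₁ e₂ e} c₁ c₂ → m ∣ e₁ → m ∣ e₂ → e ≡ c₁ * e₁ + c₂ * e₂ → m ∣ e
  ∣-lincomb₂ {m} c₁ c₂ d₁ d₂ e≡ = subst (m ∣_) (sym e≡) (∣m∣n⇒∣m+n (∣n⇒∣m*n c₁ d₁) (∣n⇒∣m*n c₂ d₂))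

  ∣-lincomb₃ : ∀ {m e₁ e₂ e₃ e} c₁ c₂ c₃ → m ∣ e₁ → m ∣ e₂ → m ∣ e₃ →
               e ≡ c₁ * e₁ + c₂ * e₂ + c₃ * e₃ → m ∣ e
  ∣-lincomb₃ {m} c₁ c₂ c₃ d₁ d₂ d₃ e≡ = subst (m ∣_) (sym e≡) (∣m∣n⇒∣m+n (∣-lincomb₂ c₁ c₂ d₁ d₂ refl) (∣n⇒∣m*n c₃ d₃))

  pos-^ : ∀ a n → + (a ℕ.^ n) ≡ (+ a) ^ n
  pos-^ a zero    = refl
  pos-^ a (suc n) = trans (ℤ.pos-* a (a ℕ.^ n)) (cong (+ a *_) (pos-^ a n))

  ^-distribʳ-* : ∀ a b n → (a * b) ^ n ≡ a ^ n * b ^ n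
  ^-distribʳ-* a b zero    = refl
  ^-distribʳ-* a b (suc n) = trans (cong (a * b *_) (^-distribʳ-* a b n)) (interchange a b (a ^ n) (b ^ n))
    where
    interchange : ∀ a b x y → a * b * (x * y) ≡ a * x * (b * y)
    interchange = solve-∀

  ∣a-b⇒∣aⁿ-bⁿ : ∀ {m} a b n → m ∣ a - b → m ∣ a ^ n - b ^ n
  ∣a-b⇒∣aⁿ-bⁿ a b zero    _     = divides 0ℤ (ℤ.+-inverseʳ 1ℤ)
  ∣a-b⇒∣aⁿ-bⁿ a b (suc n) m∣a-b = ∣-lincomb₂ a (b ^ n) (∣a-b⇒∣aⁿ-bⁿ a b n m∣a-b) m∣a-b (telescope a b (a ^ n) (b ^ n))
    where
    telescope : ∀ a b x y → a * x - b * y ≡ a * (x - y) + y * (a - b)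
    telescope = solve-∀

  expansionError : ℤ → ℤ → ℤ → ℕ → ℤ
  expansionError m b t k = (b + t * m) ^ suc k - b ^ suc k - + suc k * t * m * b ^ k

  expansionError-step : ∀ m b t k → expansionError m b t (suc k)
    ≡ (b + t * m) * expansionError m b t k + (+ suc k * t * t * b ^ k) * (1ℤ * (m * m))
  expansionError-step m b t k = step m b t (+ suc k) ((b + t * m) ^ suc k) (b ^ k)
    where
    step : ∀ m b t k X Z →
      (b + t * m) * X - b * (b * Z) - (1ℤ + k) * t * m * (b * Z)
        ≡ (b + t * m) * (X - b * Z - k * t * m * Z) + (k * t * t * Z) * (1ℤ * (m * m))
    step = solve-∀

  m²∣expansionError : ∀ m b t k → m * m ∣ expansionError m b t k
  m²∣expansionError m b t zero    = divides 0ℤ (base m b t)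
    where
    base : ∀ m b t → (b + t * m) * 1ℤ - b * 1ℤ - 1ℤ * t * m * 1ℤ ≡ 0ℤ * (m * m)
    base = solve-∀
  m²∣expansionError m b t (suc k) =
    ∣-lincomb₂ (b + t * m) (+ suc k * t * t * b ^ k) (m²∣expansionError m b t k) (divides 1ℤ refl)
      (expansionError-step m b t k)

  -- Writing a = b + t m, the linear term m · t m · bᵐ⁻¹ of the expansion of aᵐ is already divisible by m².
  ∣a-b⇒m²∣aᵐ-bᵐ : ∀ n a b → + suc n ∣ a - b → + suc n * + suc n ∣ a ^ suc n - b ^ suc n
  ∣a-b⇒m²∣aᵐ-bᵐ n a b (divides t a-b≡tm) = subst (λ a → m * m ∣ a ^ suc n - b ^ suc n) b+tm≡a
    (∣-lincomb₂ 1ℤ (t * b ^ n) (m²∣expansionError m b t n) (divides 1ℤ refl)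
      (split ((b + t * m) ^ suc n) (b ^ suc n) (b ^ n) m t))
    where
    m : ℤ
    m = + suc n
    b+tm≡a : b + t * m ≡ a
    b+tm≡a = trans (cong (λ x → b + x) (sym a-b≡tm)) (reassemble a b)
      where
      reassemble : ∀ a b → b + (a - b) ≡ a
      reassemble = solve-∀
    split : ∀ X Y Z m t → X - Y ≡ 1ℤ * (X - Y - m * t * m * Z) + (t * Z) * (1ℤ * (m * m))
    split = solve-∀


module OddPrime (n : ℕ) (prime : Prime (suc n)) (j : ℕ) (n≡j+j : n ≡ j ℕ.+ j) where
  open import Data.Empty using (⊥-elim)
  open import Data.Fin.Patterns using (0F; 1F; 2F; 3F; 4F; 5F)
  open import Data.Integer as ℤ using (ℤ; +_; -_; 0ℤ; 1ℤ; -1ℤ; _+_; _-_; _*_; _^_)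
  import Data.Integer.Divisibility as ℤD
  open import Data.Integer.Divisibility.Signed as ℤ∣
    using (_∣_; _∣?_; divides; ∣n⇒∣m*n; ∣m⇒∣m*n; ∣-refl; ∣-trans; ∣ᵤ⇒∣; ∣⇒∣ᵤ; *-monoˡ-∣; *-cancelˡ-∣; *-cancelʳ-∣)
  import Data.Integer.DivMod as ℤ
  import Data.Integer.Properties as ℤ
  open import Data.Integer.Tactic.RingSolver
  open import Data.List as List using (List; filter; upTo)
  open import Data.List.Membership.Propositional using (lose; find)
  open import Data.List.Membership.Propositional.Properties using (∈-filter⁺; ∈-filter⁻; ∈-upTo⁺)
  import Data.List.Relation.Unary.All as All
  open All using ([]; _∷_)
  import Data.List.Relation.Unary.All.Properties as All
  import Data.List.Relation.Unary.AllPairs as AllPairs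
  open AllPairs using ([]; _∷_)
  import Data.List.Relation.Unary.AllPairs.Properties as AllPairs
  import Data.List.Relation.Unary.Any.Properties as Any
  import Data.List.Relation.Unary.Unique.Propositional.Properties as Unique
  open import Data.Nat as ℕ using (ℕ; zero; suc)
  import Data.Nat.Divisibility as ℕ∣
  import Data.Nat.DivMod as ℕ
  open import Data.Nat.Primality using (Prime; euclidsLemma)
  import Data.Nat.Properties as ℕ
  open import Data.Product using (∃-syntax; _,_; proj₁; proj₂; _×_)
  open import Data.Sum as Sum using (_⊎_; inj₁; inj₂; [_,_]′)
  open import Data.Vec as Vec using (Vec; []; _∷_)
  open import Data.Vec.Membership.Propositional using (_∈_)
  open import Data.Vec.Membership.Propositional.Properties using (∈-lookup)
  open import Data.Vec.Relation.Unary.All using (All; []; _∷_)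
  import Data.Vec.Relation.Unary.All as AllV
  import Data.Vec.Relation.Unary.All.Properties as AllV
  open import Data.Vec.Relation.Unary.AllPairs using ([]; _∷_)
  open import Data.Vec.Relation.Unary.Any using (here; there)
  open import Data.Vec.Relation.Unary.Unique.Propositional using (Unique)
  open import Data.Vec.Relation.Unary.Unique.Propositional.Properties using (lookup-injective)
  open import Defs using (_≋_[_]; fval; IsRoot; SixPack; Disjoint; InPacks; Wieferich; InW; RootShape; NonWiefShape; WiefShape)
  open import Function using (_∘_)
  open import Function.Bundles using (_⇔_; mk⇔; module Equivalence)
  open import Relation.Binary.PropositionalEquality
  open import Relation.Nullary using (¬_; yes; no)
  open import Relation.Nullary.Decidable using (_×-dec_; _⊎-dec_; ¬?)
  open import Relation.Unary using (Decidable)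

  open BinomialModPrime using (prime∤1; freshmansDream)
  open IntegerPowers
  open VecMinimum

  p : ℕ
  p = suc n

  P : ℤ
  P = + p

  N : ℤ → ℤ
  N x = (x + 1ℤ) ^ p - x ^ p - 1ℤ

  Root : ℤ → Set
  Root x = P * P ∣ N x

  N-cong : ∀ x y → P ∣ x - y → P * P ∣ N x - N y
  N-cong x y P∣x-y = ∣-lincomb₂ 1ℤ -1ℤ
    (∣a-b⇒m²∣aᵐ-bᵐ n (x + 1ℤ) (y + 1ℤ) (∣-lincomb₁ 1ℤ P∣x-y (shift x y)))
    (∣a-b⇒m²∣aᵐ-bᵐ n x y P∣x-y)
    (difference ((x + 1ℤ) ^ p) (x ^ p) ((y + 1ℤ) ^ p) (y ^ p))
    where
    shift : ∀ x y → (x + 1ℤ) - (y + 1ℤ) ≡ 1ℤ * (x - y)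
    shift = solve-∀
    difference : ∀ A B C D → (A - B - 1ℤ) - (C - D - 1ℤ) ≡ 1ℤ * (A - C) + -1ℤ * (B - D)
    difference = solve-∀

  Root-cong : ∀ x y → P ∣ x - y → Root y → Root x
  Root-cong x y P∣x-y Ry = ∣-lincomb₂ 1ℤ 1ℤ (N-cong x y P∣x-y) Ry (identity (N x) (N y))
    where
    identity : ∀ a b → a ≡ 1ℤ * (a - b) + 1ℤ * b
    identity = solve-∀

  [-a]ᵖ≡-aᵖ : ∀ a → (- a) ^ p ≡ - (a ^ p)
  [-a]ᵖ≡-aᵖ a = begin
    (- a) ^ p                   ≡⟨ cong (_^ p) (sym (ℤ.-1*i≡-i a)) ⟩
    (-1ℤ * a) ^ p               ≡⟨ ^-distribʳ-* -1ℤ a p ⟩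
    -1ℤ ^ p * a ^ p             ≡⟨ cong (λ k → -1ℤ ^ suc k * a ^ p) n≡j+j ⟩
    -1ℤ * -1ℤ ^ (j ℕ.+ j) * a ^ p ≡⟨ cong (λ z → -1ℤ * z * a ^ p) [-1]²ʲ≡1 ⟩
    -1ℤ * 1ℤ * a ^ p            ≡⟨ ℤ.-1*i≡-i (a ^ p) ⟩
    - (a ^ p)                   ∎
    where
    open ≡-Reasoning
    [-1]²ʲ≡1 : -1ℤ ^ (j ℕ.+ j) ≡ 1ℤ
    [-1]²ʲ≡1 = trans (ℤ.^-distribˡ-+-* -1ℤ j j) (trans (sym (^-distribʳ-* -1ℤ -1ℤ j)) (ℤ.^-zeroˡ j))

  N[-x-1]≡N[x] : ∀ x → N (- x - 1ℤ) ≡ N x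
  N[-x-1]≡N[x] x = begin
    (- x - 1ℤ + 1ℤ) ^ p - (- x - 1ℤ) ^ p - 1ℤ  ≡⟨ cong₂ (λ u v → u ^ p - v ^ p - 1ℤ) (identity₁ x) (identity₂ x) ⟩
    (- x) ^ p - (- (x + 1ℤ)) ^ p - 1ℤ          ≡⟨ cong₂ (λ u v → u - v - 1ℤ) ([-a]ᵖ≡-aᵖ x) ([-a]ᵖ≡-aᵖ (x + 1ℤ)) ⟩
    - (x ^ p) - - ((x + 1ℤ) ^ p) - 1ℤ          ≡⟨ identity₃ (x ^ p) ((x + 1ℤ) ^ p) ⟩
    N x                                        ∎
    where
    open ≡-Reasoning
    identity₁ : ∀ x → - x - 1ℤ + 1ℤ ≡ - x
    identity₁ = solve-∀
    identity₂ : ∀ x → - x - 1ℤ ≡ - (x + 1ℤ)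
    identity₂ = solve-∀
    identity₃ : ∀ A B → - A - - B - 1ℤ ≡ B - A - 1ℤ
    identity₃ = solve-∀

  Root-reflect : ∀ x y → P ∣ y - (- x - 1ℤ) → Root x → Root y
  Root-reflect x y P∣y+x+1 Rx = Root-cong y (- x - 1ℤ) P∣y+x+1 (subst (P * P ∣_) (sym (N[-x-1]≡N[x] x)) Rx)

  -- yᵖ N(x) = (y(x+1))ᵖ - (yx)ᵖ - yᵖ ≡ (y+1)ᵖ - 1 - yᵖ = N(y) modulo p², as y(x+1) ≡ y+1 and yx ≡ 1 mod p.
  Root-invert : ∀ x y → P ∣ x * y - 1ℤ → Root x → Root y
  Root-invert x y P∣xy-1 Rx = ∣-lincomb₃ 1ℤ -1ℤ 1ℤ
    (subst (P * P ∣_) yᵖN[x]≡ (∣n⇒∣m*n (y ^ p) Rx))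
    (∣a-b⇒m²∣aᵐ-bᵐ n (y * (x + 1ℤ)) (y + 1ℤ) (∣-lincomb₁ 1ℤ P∣xy-1 (identity₁ x y)))
    (subst (λ z → P * P ∣ (y * x) ^ p - z) (ℤ.^-zeroˡ p) (∣a-b⇒m²∣aᵐ-bᵐ n (y * x) 1ℤ (∣-lincomb₁ 1ℤ P∣xy-1 (identity₂ x y))))
    (identity₃ (y ^ p) ((y * (x + 1ℤ)) ^ p) ((y + 1ℤ) ^ p) ((y * x) ^ p))
    where
    yᵖN[x]≡ : y ^ p * N x ≡ (y * (x + 1ℤ)) ^ p - (y * x) ^ p - y ^ p
    yᵖN[x]≡ = trans (distribute (y ^ p) ((x + 1ℤ) ^ p) (x ^ p))
      (cong₂ (λ u v → u - v - y ^ p) (sym (^-distribʳ-* y (x + 1ℤ) p)) (sym (^-distribʳ-* y x p)))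
      where
      distribute : ∀ Y X₁ X₂ → Y * (X₁ - X₂ - 1ℤ) ≡ Y * X₁ - Y * X₂ - Y
      distribute = solve-∀
    identity₁ : ∀ x y → y * (x + 1ℤ) - (y + 1ℤ) ≡ 1ℤ * (x * y - 1ℤ)
    identity₁ = solve-∀
    identity₂ : ∀ x y → y * x - 1ℤ ≡ 1ℤ * (x * y - 1ℤ)
    identity₂ = solve-∀
    identity₃ : ∀ Y A B C → B - Y - 1ℤ ≡ 1ℤ * (A - C - Y) + -1ℤ * (A - B) + 1ℤ * (C - 1ℤ)
    identity₃ = solve-∀

  N≡P*fval : ∀ x → N (+ x) ≡ P * + fval p x
  N≡P*fval x = begin
    (+ x + 1ℤ) ^ p - (+ x) ^ p - 1ℤ                  ≡⟨ cong (λ z → z - (+ x) ^ p - 1ℤ) (sym (pos-^ (x ℕ.+ 1) p)) ⟩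
    + ((x ℕ.+ 1) ℕ.^ p) - (+ x) ^ p - 1ℤ             ≡⟨ cong (λ z → + z - (+ x) ^ p - 1ℤ) [x+1]ᵖ≡ ⟩
    + (x ℕ.^ p ℕ.+ (1 ℕ.+ p ℕ.* M)) - (+ x) ^ p - 1ℤ ≡⟨ cong (λ z → z - (+ x) ^ p - 1ℤ) cast ⟩
    (+ x) ^ p + (1ℤ + P * + M) - (+ x) ^ p - 1ℤ      ≡⟨ cancel ((+ x) ^ p) (P * + M) ⟩
    P * + M                                          ≡⟨ cong (λ m → P * + m) (sym fval≡M) ⟩
    P * + fval p x                                   ∎
    where
    open ≡-Reasoning
    M : ℕ
    M = proj₁ (freshmansDream prime x)
    [x+1]ᵖ≡ : (x ℕ.+ 1) ℕ.^ p ≡ x ℕ.^ p ℕ.+ (1 ℕ.+ p ℕ.* M)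
    [x+1]ᵖ≡ = proj₂ (freshmansDream prime x)
    cast : + (x ℕ.^ p ℕ.+ (1 ℕ.+ p ℕ.* M)) ≡ (+ x) ^ p + (1ℤ + P * + M)
    cast = trans (ℤ.pos-+ (x ℕ.^ p) (1 ℕ.+ p ℕ.* M)) (cong₂ (λ u v → u + (1ℤ + v)) (pos-^ x p) (ℤ.pos-* p M))
    cancel : ∀ X Y → X + (1ℤ + Y) - X - 1ℤ ≡ Y
    cancel = solve-∀
    fval≡M : fval p x ≡ M
    fval≡M = begin
      ((x ℕ.+ 1) ℕ.^ p ℕ.∸ x ℕ.^ p ℕ.∸ 1) ℕ./ p              ≡⟨ cong (λ z → (z ℕ.∸ x ℕ.^ p ℕ.∸ 1) ℕ./ p) [x+1]ᵖ≡ ⟩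
      (x ℕ.^ p ℕ.+ (1 ℕ.+ p ℕ.* M) ℕ.∸ x ℕ.^ p ℕ.∸ 1) ℕ./ p ≡⟨ cong (λ z → (z ℕ.∸ 1) ℕ./ p) (ℕ.m+n∸m≡n (x ℕ.^ p) _) ⟩
      (p ℕ.* M) ℕ./ p                                        ≡⟨ cong (ℕ._/ p) (ℕ.*-comm p M) ⟩
      (M ℕ.* p) ℕ./ p                                        ≡⟨ ℕ.m*n/n≡m M p ⟩
      M                                                      ∎

  fermat : ∀ x → P ∣ (+ x) ^ p - + x
  fermat zero    = divides 0ℤ refl
  fermat (suc x) = subst (λ z → P ∣ z ^ p - z) (cong +_ (ℕ.+-comm x 1))
    (∣-lincomb₂ 1ℤ 1ℤ (fermat x) (subst (P ∣_) (sym (N≡P*fval x)) (∣m⇒∣m*n (+ fval p x) ∣-refl))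
      (identity (+ x) ((+ x + 1ℤ) ^ p) ((+ x) ^ p)))
    where
    identity : ∀ x A B → A - (x + 1ℤ) ≡ 1ℤ * (B - x) + 1ℤ * (A - B - 1ℤ)
    identity = solve-∀

  IsRoot⇒Root : ∀ x → IsRoot p x → Root (+ x)
  IsRoot⇒Root x (ℕ∣.divides k fval≡kp) = divides (+ k) (begin
    N (+ x)          ≡⟨ N≡P*fval x ⟩
    P * + fval p x   ≡⟨ cong (λ z → P * + z) fval≡kp ⟩
    P * + (k ℕ.* p)  ≡⟨ cong (P *_) (ℤ.pos-* k p) ⟩
    P * (+ k * P)    ≡⟨ rotate P (+ k) ⟩
    + k * (P * P)    ∎)
    where
    open ≡-Reasoning
    rotate : ∀ P k → P * (k * P) ≡ k * (P * P)
    rotate = solve-∀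

  Root⇒IsRoot : ∀ x → Root (+ x) → IsRoot p x
  Root⇒IsRoot x P²∣N = ∣⇒∣ᵤ (*-cancelˡ-∣ P {P} {+ fval p x} (subst (P * P ∣_) (N≡P*fval x) P²∣N))

  -- Arithmetic modulo p

  P∤1 : ¬ P ∣ 1ℤ
  P∤1 P∣1 = prime∤1 prime (∣⇒∣ᵤ P∣1)

  euclidsLemmaℤ : ∀ a b → P ∣ a * b → P ∣ a ⊎ P ∣ b
  euclidsLemmaℤ a b P∣ab with euclidsLemma ℤ.∣ a ∣ ℤ.∣ b ∣ prime (subst (p ℕ∣.∣_) (ℤ.abs-* a b) (∣⇒∣ᵤ P∣ab))
  ... | inj₁ p∣a = inj₁ (∣ᵤ⇒∣ p∣a)
  ... | inj₂ p∣b = inj₂ (∣ᵤ⇒∣ p∣b)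

  ∣-cancelˡ : ∀ u v → ¬ P ∣ u → P ∣ u * v → P ∣ v
  ∣-cancelˡ u v P∤u P∣uv with euclidsLemmaℤ u v P∣uv
  ... | inj₁ P∣u = ⊥-elim (P∤u P∣u)
  ... | inj₂ P∣v = P∣v

  P²∣-cancelˡ : ∀ u v → ¬ P ∣ u → P * P ∣ u * v → P * P ∣ v
  P²∣-cancelˡ u v P∤u P²∣uv = subst (P * P ∣_) (sym v≡wP) (*-monoˡ-∣ P P∣w)
    where
    P∣v : P ∣ v
    P∣v = ∣-cancelˡ u v P∤u (∣-trans (∣m⇒∣m*n P ∣-refl) P²∣uv)
    w : ℤ
    w = ℤ∣._∣_.quotient P∣v
    v≡wP : v ≡ w * P
    v≡wP = ℤ∣._∣_.equality P∣v
    P∣w : P ∣ w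
    P∣w = ∣-cancelˡ u w P∤u (*-cancelʳ-∣ P (subst (P * P ∣_) (trans (cong (u *_) v≡wP) (sym (ℤ.*-assoc u w P))) P²∣uv))

  solution-unique : ∀ L v w r → ¬ P ∣ L → P ∣ v * L - r → P ∣ w * L - r → P ∣ v - w
  solution-unique L v w r P∤L P∣vL-r P∣wL-r = ∣-cancelˡ L (v - w) P∤L (∣-lincomb₂ 1ℤ -1ℤ P∣vL-r P∣wL-r (identity v w L r))
    where
    identity : ∀ v w L r → L * (v - w) ≡ 1ℤ * (v * L - r) + -1ℤ * (w * L - r)
    identity = solve-∀

  abstract
    residue : ℤ → ℕ
    residue z = z ℤ.%ℕ p

    residue<p : ∀ z → residue z ℕ.< p
    residue<p z = ℤ.n%ℕd<d z p

    residue-cong : ∀ z → P ∣ + residue z - z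
    residue-cong z = divides (- (z ℤ./ℕ p)) (trans (cong (λ w → + residue z - w) (ℤ.a≡a%ℕn+[a/ℕn]*n z p))
      (identity (+ residue z) (z ℤ./ℕ p) P))
      where
      identity : ∀ r q P → r - (r + q * P) ≡ - q * P
      identity = solve-∀

  multiple<p⇒≡0 : ∀ {d} → d ℕ.< p → p ℕ∣.∣ d → d ≡ 0
  multiple<p⇒≡0 {d} d<p p∣d = trans (sym (ℕ.m<n⇒m%n≡m d<p)) (ℕ∣.n∣m⇒m%n≡0 d p p∣d)

  residue-unique : ∀ x y → x ℕ.< p → y ℕ.< p → P ∣ + x - + y → x ≡ y
  residue-unique x y x<p y<p P∣x-y = ≤-total-case (ℕ.≤-total x y)
    where
    p∣∣x⊖y∣ : p ℕ∣.∣ ℤ.∣ x ℤ.⊖ y ∣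
    p∣∣x⊖y∣ = subst (p ℕ∣.∣_) (cong ℤ.∣_∣ (ℤ.m-n≡m⊖n x y)) (∣⇒∣ᵤ P∣x-y)
    ≤-total-case : x ℕ.≤ y ⊎ y ℕ.≤ x → x ≡ y
    ≤-total-case (inj₁ x≤y) = ℕ.≤-antisym x≤y (ℕ.m∸n≡0⇒m≤n (multiple<p⇒≡0 (ℕ.≤-<-trans (ℕ.m∸n≤m y x) y<p)
      (subst (p ℕ∣.∣_) (ℤ.∣⊖∣-≤ x≤y) p∣∣x⊖y∣)))
    ≤-total-case (inj₂ y≤x) = ℕ.≤-antisym (ℕ.m∸n≡0⇒m≤n (multiple<p⇒≡0 (ℕ.≤-<-trans (ℕ.m∸n≤m x y) x<p)
      (subst (p ℕ∣.∣_) (trans (ℤ.∣m⊖n∣≡∣n⊖m∣ x y) (ℤ.∣⊖∣-≤ y≤x)) p∣∣x⊖y∣))) y≤x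

  private
    n≡1+[n∸1] : n ≡ suc (n ℕ.∸ 1)
    n≡1+[n∸1] = sym (ℕ.suc-pred n ⦃ ℕ.≢-nonZero n≢0 ⦄)
      where
      n≢0 : n ≢ 0
      n≢0 n≡0 = prime∤1 prime (subst (λ m → suc m ℕ∣.∣ 1) (sym n≡0) ℕ∣.∣-refl)

  inv : ℕ → ℤ
  inv a = (+ a) ^ (n ℕ.∸ 1)

  inv-inverse : ∀ a → ¬ P ∣ + a → P ∣ + a * inv a - 1ℤ
  inv-inverse a P∤a = subst (λ k → P ∣ (+ a) ^ k - 1ℤ) n≡1+[n∸1]
    (∣-cancelˡ (+ a) ((+ a) ^ n - 1ℤ) P∤a (subst (P ∣_) (factor (+ a) ((+ a) ^ n)) (fermat a)))
    where
    factor : ∀ U X → U * X - U ≡ U * (X - 1ℤ)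
    factor = solve-∀

  inv-inverse-suc : ∀ a → ¬ P ∣ + a + 1ℤ → P ∣ (+ a + 1ℤ) * inv (a ℕ.+ 1) - 1ℤ
  inv-inverse-suc a P∤a+1 = subst (λ u → P ∣ u * inv (a ℕ.+ 1) - 1ℤ) (ℤ.pos-+ a 1)
    (inv-inverse (a ℕ.+ 1) (P∤a+1 ∘ subst (P ∣_) (ℤ.pos-+ a 1)))

  ∣w³-1⇒∣w³ᵏ-1 : ∀ {m} w k → m ∣ w * w * w - 1ℤ → m ∣ w ^ (3 ℕ.* k) - 1ℤ
  ∣w³-1⇒∣w³ᵏ-1 w k m∣w³-1 = subst₂ (λ u v → _ ∣ u - v) (ℤ.^-*-assoc w 3 k) (ℤ.^-zeroˡ k)
    (∣a-b⇒∣aⁿ-bⁿ (w ^ 3) 1ℤ k (∣-lincomb₁ 1ℤ m∣w³-1 (identity w)))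
    where
    identity : ∀ w → w * (w * (w * 1ℤ)) - 1ℤ ≡ 1ℤ * (w * w * w - 1ℤ)
    identity = solve-∀

  -- For p ≡ 1 (mod 3): ω = ζᵖ satisfies ω² + ω + 1 ≡ 0 and ωᵖ ≡ ω modulo p², so
  -- (ω + 1)ᵖ = (-ω²)ᵖ ≡ -ω² ≡ ω + 1 and N(ω) ≡ 0; and ζ ≡ ω mod p.
  primitiveCubeRoot⇒Root : ∀ k → n ≡ 3 ℕ.* k → ∀ ζ → P ∣ + ζ * + ζ * + ζ - 1ℤ → ¬ P ∣ + ζ - 1ℤ → Root (+ ζ)
  primitiveCubeRoot⇒Root k n≡3k ζ P∣ζ³-1 P∤ζ-1 = Root-cong (+ ζ) ω (∣-lincomb₁ -1ℤ (fermat ζ) (identity₁ (+ ζ) ω)) Rω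
    where
    ω : ℤ
    ω = (+ ζ) ^ p
    identity₁ : ∀ Z w → Z - w ≡ -1ℤ * (w - Z)
    identity₁ = solve-∀
    P²∣ω³-1 : P * P ∣ ω * ω * ω - 1ℤ
    P²∣ω³-1 = subst₂ (λ u v → P * P ∣ u - v) ω³≡ (ℤ.^-zeroˡ p) (∣a-b⇒m²∣aᵐ-bᵐ n (+ ζ * + ζ * + ζ) 1ℤ P∣ζ³-1)
      where
      ω³≡ : (+ ζ * + ζ * + ζ) ^ p ≡ ω * ω * ω
      ω³≡ = trans (^-distribʳ-* (+ ζ * + ζ) (+ ζ) p) (cong (_* ω) (^-distribʳ-* (+ ζ) (+ ζ) p))
    P∤ω-1 : ¬ P ∣ ω - 1ℤ
    P∤ω-1 P∣ω-1 = P∤ζ-1 (∣-lincomb₂ -1ℤ 1ℤ (fermat ζ) P∣ω-1 (identity (+ ζ) ω))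
      where
      identity : ∀ Z w → Z - 1ℤ ≡ -1ℤ * (w - Z) + 1ℤ * (w - 1ℤ)
      identity = solve-∀
    P²∣ω²+ω+1 : P * P ∣ ω * ω + ω + 1ℤ
    P²∣ω²+ω+1 = P²∣-cancelˡ (ω - 1ℤ) _ P∤ω-1 (subst (P * P ∣_) (sym (identity ω)) P²∣ω³-1)
      where
      identity : ∀ w → (w - 1ℤ) * (w * w + w + 1ℤ) ≡ w * w * w - 1ℤ
      identity = solve-∀
    P²∣ωᵖ-ω : P * P ∣ ω ^ p - ω
    P²∣ωᵖ-ω = subst (λ e → P * P ∣ ω ^ suc e - ω) (sym n≡3k)
      (subst (P * P ∣_) (sym (factor ω (ω ^ (3 ℕ.* k)))) (∣n⇒∣m*n ω (∣w³-1⇒∣w³ᵏ-1 ω k P²∣ω³-1)))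
      where
      factor : ∀ w X → w * X - w ≡ w * (X - 1ℤ)
      factor = solve-∀
    P²∣[ω+1]ᵖ+ω²ᵖ : P * P ∣ (ω + 1ℤ) ^ p - - (ω ^ p * ω ^ p)
    P²∣[ω+1]ᵖ+ω²ᵖ = subst (λ v → P * P ∣ (ω + 1ℤ) ^ p - v) [-ω²]ᵖ≡
      (∣a-b⇒∣aⁿ-bⁿ (ω + 1ℤ) (- (ω * ω)) p (∣-lincomb₁ 1ℤ P²∣ω²+ω+1 (identity ω)))
      where
      [-ω²]ᵖ≡ : (- (ω * ω)) ^ p ≡ - (ω ^ p * ω ^ p)
      [-ω²]ᵖ≡ = trans ([-a]ᵖ≡-aᵖ (ω * ω)) (cong -_ (^-distribʳ-* ω ω p))
      identity : ∀ w → (w + 1ℤ) - - (w * w) ≡ 1ℤ * (w * w + w + 1ℤ)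
      identity = solve-∀
    Rω : Root ω
    Rω = ∣-lincomb₃ 1ℤ (- (ω ^ p + ω + 1ℤ)) -1ℤ P²∣[ω+1]ᵖ+ω²ᵖ P²∣ωᵖ-ω P²∣ω²+ω+1 (identity ω (ω ^ p) ((ω + 1ℤ) ^ p))
      where
      identity : ∀ w X Y → Y - X - 1ℤ ≡ 1ℤ * (Y - - (X * X)) + (- (X + w + 1ℤ)) * (X - w) + -1ℤ * (w * w + w + 1ℤ)
      identity = solve-∀

  -- Six-packs

  pb pc pd pe pf : ℕ → ℕ
  pb a = residue (- + a - 1ℤ)
  pc a = residue (- inv (a ℕ.+ 1))
  pd a = residue (- + a * inv (a ℕ.+ 1))
  pe a = residue (- (+ a + 1ℤ) * inv a)
  pf a = residue (inv a)

  pack : ℕ → Vec ℕ 6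
  pack a = a ∷ pb a ∷ pc a ∷ pd a ∷ pe a ∷ pf a ∷ []

  Nondegenerate : ℕ → Set
  Nondegenerate a = ¬ P ∣ + a × ¬ P ∣ + a + 1ℤ

  pb-cong : ∀ a → P ∣ + pb a - (- + a - 1ℤ)
  pb-cong a = residue-cong (- + a - 1ℤ)

  module _ (a : ℕ) (nd : Nondegenerate a) where
    private
      A : ℤ
      A = + a
      P∤a : ¬ P ∣ A
      P∤a = proj₁ nd
      P∤a+1 : ¬ P ∣ A + 1ℤ
      P∤a+1 = proj₂ nd

    pc-cong : P ∣ + pc a * (A + 1ℤ) - - 1ℤ
    pc-cong = ∣-lincomb₂ (A + 1ℤ) -1ℤ (residue-cong (- inv (a ℕ.+ 1))) (inv-inverse-suc a P∤a+1) (identity (+ pc a) A (inv (a ℕ.+ 1)))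
      where
      identity : ∀ c A J → c * (A + 1ℤ) - - 1ℤ ≡ (A + 1ℤ) * (c - - J) + -1ℤ * ((A + 1ℤ) * J - 1ℤ)
      identity = solve-∀

    pd-cong : P ∣ + pd a * (A + 1ℤ) - - A
    pd-cong = ∣-lincomb₂ (A + 1ℤ) (- A) (residue-cong (- A * inv (a ℕ.+ 1))) (inv-inverse-suc a P∤a+1) (identity (+ pd a) A (inv (a ℕ.+ 1)))
      where
      identity : ∀ d A J → d * (A + 1ℤ) - - A ≡ (A + 1ℤ) * (d - - A * J) + (- A) * ((A + 1ℤ) * J - 1ℤ)
      identity = solve-∀

    pe-cong : P ∣ + pe a * A - - (A + 1ℤ)
    pe-cong = ∣-lincomb₂ A (- (A + 1ℤ)) (residue-cong (- (A + 1ℤ) * inv a)) (inv-inverse a P∤a) (identity (+ pe a) A (inv a))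
      where
      identity : ∀ e A J → e * A - - (A + 1ℤ) ≡ A * (e - - (A + 1ℤ) * J) + (- (A + 1ℤ)) * (A * J - 1ℤ)
      identity = solve-∀

    pf-cong : P ∣ + pf a * A - 1ℤ
    pf-cong = ∣-lincomb₂ A 1ℤ (residue-cong (inv a)) (inv-inverse a P∤a) (identity (+ pf a) A (inv a))
      where
      identity : ∀ f A J → f * A - 1ℤ ≡ A * (f - J) + 1ℤ * (A * J - 1ℤ)
      identity = solve-∀

  Nondegenerate-pb : ∀ a → Nondegenerate a → Nondegenerate (pb a)
  Nondegenerate-pb a (P∤a , P∤a+1) =
      (λ P∣b → P∤a+1 (∣-lincomb₂ 1ℤ -1ℤ (pb-cong a) P∣b (identity₁ (+ a) (+ pb a))))
    , (λ P∣b+1 → P∤a (∣-lincomb₂ 1ℤ -1ℤ (pb-cong a) P∣b+1 (identity₂ (+ a) (+ pb a))))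
    where
    identity₁ : ∀ A B → A + 1ℤ ≡ 1ℤ * (B - (- A - 1ℤ)) + -1ℤ * B
    identity₁ = solve-∀
    identity₂ : ∀ A B → A ≡ 1ℤ * (B - (- A - 1ℤ)) + -1ℤ * (B + 1ℤ)
    identity₂ = solve-∀

  Nondegenerate-pf : ∀ a → Nondegenerate a → Nondegenerate (pf a)
  Nondegenerate-pf a nd@(_ , P∤a+1) =
      (λ P∣f → P∤1 (∣-lincomb₂ (+ a) -1ℤ P∣f (pf-cong a nd) (identity₁ (+ a) (+ pf a))))
    , (λ P∣f+1 → P∤a+1 (∣-lincomb₂ (+ a) -1ℤ P∣f+1 (pf-cong a nd) (identity₂ (+ a) (+ pf a))))
    where
    identity₁ : ∀ A F → 1ℤ ≡ A * F + -1ℤ * (F * A - 1ℤ)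
    identity₁ = solve-∀
    identity₂ : ∀ A F → A + 1ℤ ≡ A * (F + 1ℤ) + -1ℤ * (F * A - 1ℤ)
    identity₂ = solve-∀

  module _ (a : ℕ) (a<p : a ℕ.< p) (nd : Nondegenerate a) where
    private
      A B : ℤ
      A = + a
      B = + pb a
      b : ℕ
      b = pb a
      nd-b : Nondegenerate b
      nd-b = Nondegenerate-pb a nd
      P∣B+A+1 : P ∣ B - (- A - 1ℤ)
      P∣B+A+1 = pb-cong a
      P∤A : ¬ P ∣ A
      P∤A = proj₁ nd
      P∤A+1 : ¬ P ∣ A + 1ℤ
      P∤A+1 = proj₂ nd

    pb-pb : pb b ≡ a
    pb-pb = residue-unique _ _ (residue<p _) a<p (∣-lincomb₂ 1ℤ -1ℤ (pb-cong b) P∣B+A+1 (identity (+ pb b) A B))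
      where
      identity : ∀ v A B → v - A ≡ 1ℤ * (v - (- B - 1ℤ)) + -1ℤ * (B - (- A - 1ℤ))
      identity = solve-∀

    pc-pb : pc b ≡ pf a
    pc-pb = residue-unique _ _ (residue<p _) (residue<p _) (solution-unique A (+ pc b) (+ pf a) 1ℤ P∤A
      (∣-lincomb₂ -1ℤ (+ pc b) (pc-cong b nd-b) P∣B+A+1 (identity (+ pc b) A B)) (pf-cong a nd))
      where
      identity : ∀ v A B → v * A - 1ℤ ≡ -1ℤ * (v * (B + 1ℤ) - - 1ℤ) + v * (B - (- A - 1ℤ))
      identity = solve-∀

    pd-pb : pd b ≡ pe a
    pd-pb = residue-unique _ _ (residue<p _) (residue<p _) (solution-unique A (+ pd b) (+ pe a) (- (A + 1ℤ)) P∤A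
      (∣-lincomb₂ -1ℤ (+ pd b + 1ℤ) (pd-cong b nd-b) P∣B+A+1 (identity (+ pd b) A B)) (pe-cong a nd))
      where
      identity : ∀ v A B → v * A - - (A + 1ℤ) ≡ -1ℤ * (v * (B + 1ℤ) - - B) + (v + 1ℤ) * (B - (- A - 1ℤ))
      identity = solve-∀

    pe-pb : pe b ≡ pd a
    pe-pb = residue-unique _ _ (residue<p _) (residue<p _) (solution-unique (A + 1ℤ) (+ pe b) (+ pd a) (- A) P∤A+1
      (∣-lincomb₂ -1ℤ (+ pe b + 1ℤ) (pe-cong b nd-b) P∣B+A+1 (identity (+ pe b) A B)) (pd-cong a nd))
      where
      identity : ∀ v A B → v * (A + 1ℤ) - - A ≡ -1ℤ * (v * B - - (B + 1ℤ)) + (v + 1ℤ) * (B - (- A - 1ℤ))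
      identity = solve-∀

    pf-pb : pf b ≡ pc a
    pf-pb = residue-unique _ _ (residue<p _) (residue<p _) (solution-unique (A + 1ℤ) (+ pf b) (+ pc a) (- 1ℤ) P∤A+1
      (∣-lincomb₂ -1ℤ (+ pf b) (pf-cong b nd-b) P∣B+A+1 (identity (+ pf b) A B)) (pc-cong a nd))
      where
      identity : ∀ v A B → v * (A + 1ℤ) - - 1ℤ ≡ -1ℤ * (v * B - 1ℤ) + v * (B - (- A - 1ℤ))
      identity = solve-∀

  module _ (a : ℕ) (a<p : a ℕ.< p) (nd : Nondegenerate a) where
    private
      A F : ℤ
      A = + a
      F = + pf a
      f : ℕ
      f = pf a
      nd-f : Nondegenerate f
      nd-f = Nondegenerate-pf a nd
      P∣FA-1 : P ∣ F * A - 1ℤ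
      P∣FA-1 = pf-cong a nd
      P∤A : ¬ P ∣ A
      P∤A = proj₁ nd
      P∤A+1 : ¬ P ∣ A + 1ℤ
      P∤A+1 = proj₂ nd

    pb-pf : pb f ≡ pe a
    pb-pf = residue-unique _ _ (residue<p _) (residue<p _) (solution-unique A (+ pb f) (+ pe a) (- (A + 1ℤ)) P∤A
      (∣-lincomb₂ A -1ℤ (pb-cong f) P∣FA-1 (identity A F (+ pb f))) (pe-cong a nd))
      where
      identity : ∀ A F v → v * A - - (A + 1ℤ) ≡ A * (v - (- F - 1ℤ)) + -1ℤ * (F * A - 1ℤ)
      identity = solve-∀

    pc-pf : pc f ≡ pd a
    pc-pf = residue-unique _ _ (residue<p _) (residue<p _) (solution-unique (A + 1ℤ) (+ pc f) (+ pd a) (- A) P∤A+1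
      (∣-lincomb₂ A (- + pc f) (pc-cong f nd-f) P∣FA-1 (identity A F (+ pc f))) (pd-cong a nd))
      where
      identity : ∀ A F v → v * (A + 1ℤ) - - A ≡ A * (v * (F + 1ℤ) - - 1ℤ) + (- v) * (F * A - 1ℤ)
      identity = solve-∀

    pd-pf : pd f ≡ pc a
    pd-pf = residue-unique _ _ (residue<p _) (residue<p _) (solution-unique (A + 1ℤ) (+ pd f) (+ pc a) (- 1ℤ) P∤A+1
      (∣-lincomb₂ A (- (+ pd f + 1ℤ)) (pd-cong f nd-f) P∣FA-1 (identity A F (+ pd f))) (pc-cong a nd))
      where
      identity : ∀ A F v → v * (A + 1ℤ) - - 1ℤ ≡ A * (v * (F + 1ℤ) - - F) + (- (v + 1ℤ)) * (F * A - 1ℤ)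
      identity = solve-∀

    pe-pf : pe f ≡ pb a
    pe-pf = residue-unique _ _ (residue<p _) (residue<p _)
      (∣-lincomb₃ A (- (+ pe f + 1ℤ)) -1ℤ (pe-cong f nd-f) P∣FA-1 (pb-cong a) (identity A F (+ pb a) (+ pe f)))
      where
      identity : ∀ A F B v → v - B ≡ A * (v * F - - (F + 1ℤ)) + (- (v + 1ℤ)) * (F * A - 1ℤ) + -1ℤ * (B - (- A - 1ℤ))
      identity = solve-∀

    pf-pf : pf f ≡ a
    pf-pf = residue-unique _ _ (residue<p _) a<p (∣-lincomb₂ A (- + pf f) (pf-cong f nd-f) P∣FA-1 (identity A F (+ pf f)))
      where
      identity : ∀ A F v → v - A ≡ A * (v * F - 1ℤ) + (- v) * (F * A - 1ℤ)
      identity = solve-∀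

  PrimitiveCubeRoot : ℕ → Set
  PrimitiveCubeRoot a = P ∣ + a * + a + + a + 1ℤ

  OrbitOfOne : ℕ → Set
  OrbitOfOne a = P ∣ + a - 1ℤ ⊎ P ∣ + a - - + 2 ⊎ P ∣ + 2 * + a - - 1ℤ

  Special : ℕ → Set
  Special a = PrimitiveCubeRoot a ⊎ OrbitOfOne a

  Special-pb : ∀ a → Special (pb a) → Special a
  Special-pb a (inj₁ cube) = inj₁ (∣-lincomb₂ 1ℤ (A - B) cube (pb-cong a) (identity A B))
    where
    A B : ℤ
    A = + a
    B = + pb a
    identity : ∀ A B → A * A + A + 1ℤ ≡ 1ℤ * (B * B + B + 1ℤ) + (A - B) * (B - (- A - 1ℤ))
    identity = solve-∀
  Special-pb a (inj₂ (inj₁ P∣B-1)) = inj₂ (inj₂ (inj₁ (∣-lincomb₂ 1ℤ -1ℤ (pb-cong a) P∣B-1 (identity (+ a) (+ pb a)))))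
    where
    identity : ∀ A B → A - - + 2 ≡ 1ℤ * (B - (- A - 1ℤ)) + -1ℤ * (B - 1ℤ)
    identity = solve-∀
  Special-pb a (inj₂ (inj₂ (inj₁ P∣B+2))) = inj₂ (inj₁ (∣-lincomb₂ 1ℤ -1ℤ (pb-cong a) P∣B+2 (identity (+ a) (+ pb a))))
    where
    identity : ∀ A B → A - 1ℤ ≡ 1ℤ * (B - (- A - 1ℤ)) + -1ℤ * (B - - + 2)
    identity = solve-∀
  Special-pb a (inj₂ (inj₂ (inj₂ P∣2B+1))) = inj₂ (inj₂ (inj₂ (∣-lincomb₂ (+ 2) -1ℤ (pb-cong a) P∣2B+1 (identity (+ a) (+ pb a)))))
    where
    identity : ∀ A B → + 2 * A - - 1ℤ ≡ + 2 * (B - (- A - 1ℤ)) + -1ℤ * (+ 2 * B - - 1ℤ)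
    identity = solve-∀

  Special-pf : ∀ a → Nondegenerate a → Special (pf a) → Special a
  Special-pf a nd (inj₁ cube) = inj₁ (∣-lincomb₂ (A * A) (- (F * A + 1ℤ + A)) cube (pf-cong a nd) (identity A F))
    where
    A F : ℤ
    A = + a
    F = + pf a
    identity : ∀ A F → A * A + A + 1ℤ ≡ A * A * (F * F + F + 1ℤ) + (- (F * A + 1ℤ + A)) * (F * A - 1ℤ)
    identity = solve-∀
  Special-pf a nd (inj₂ (inj₁ P∣F-1)) = inj₂ (inj₁ (∣-lincomb₂ 1ℤ (- + a) (pf-cong a nd) P∣F-1 (identity (+ a) (+ pf a))))
    where
    identity : ∀ A F → A - 1ℤ ≡ 1ℤ * (F * A - 1ℤ) + (- A) * (F - 1ℤ)
    identity = solve-∀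
  Special-pf a nd (inj₂ (inj₂ (inj₁ P∣F+2))) = inj₂ (inj₂ (inj₂ (∣-lincomb₂ -1ℤ (+ a) (pf-cong a nd) P∣F+2 (identity (+ a) (+ pf a)))))
    where
    identity : ∀ A F → + 2 * A - - 1ℤ ≡ -1ℤ * (F * A - 1ℤ) + A * (F - - + 2)
    identity = solve-∀
  Special-pf a nd (inj₂ (inj₂ (inj₂ P∣2F+1))) = inj₂ (inj₂ (inj₁ (∣-lincomb₂ (+ a) (- + 2) P∣2F+1 (pf-cong a nd) (identity (+ a) (+ pf a)))))
    where
    identity : ∀ A F → A - - + 2 ≡ A * (+ 2 * F - - 1ℤ) + (- + 2) * (F * A - 1ℤ)
    identity = solve-∀

  PrimitiveCubeRoot-cong : ∀ y w → P ∣ + y - w → P ∣ w * w + w + 1ℤ → PrimitiveCubeRoot y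
  PrimitiveCubeRoot-cong y w P∣y-w P∣w²+w+1 = ∣-lincomb₂ (+ y + w + 1ℤ) 1ℤ P∣y-w P∣w²+w+1 (identity (+ y) w)
    where
    identity : ∀ y w → y * y + y + 1ℤ ≡ (y + w + 1ℤ) * (y - w) + 1ℤ * (w * w + w + 1ℤ)
    identity = solve-∀

  Generic : ℕ → Set
  Generic a = a ℕ.< p × Nondegenerate a × ¬ Special a × Root (+ a)

  Generic-pb : ∀ {a} → Generic a → Generic (pb a)
  Generic-pb {a} (_ , nd , ¬special , root) =
    residue<p _ , Nondegenerate-pb a nd , ¬special ∘ Special-pb a , Root-reflect (+ a) (+ pb a) (pb-cong a) root

  Generic-pf : ∀ {a} → Generic a → Generic (pf a)
  Generic-pf {a} (_ , nd , ¬special , root) =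
    residue<p _ , Nondegenerate-pf a nd , ¬special ∘ Special-pf a nd ,
    Root-invert (+ a) (+ pf a) (∣-lincomb₁ 1ℤ (pf-cong a nd) (identity (+ a) (+ pf a))) root
    where
    identity : ∀ A F → A * F - 1ℤ ≡ 1ℤ * (F * A - 1ℤ)
    identity = solve-∀

  _⊆_ : Vec ℕ 6 → Vec ℕ 6 → Set
  xs ⊆ ys = ∀ {w} → w ∈ xs → w ∈ ys

  ⊆-trans : ∀ {xs ys zs} → xs ⊆ ys → ys ⊆ zs → xs ⊆ zs
  ⊆-trans xs⊆ys ys⊆zs = ys⊆zs ∘ xs⊆ys

  pack-pb⊆ : ∀ {a} → Generic a → pack (pb a) ⊆ pack a
  pack-pb⊆ {a} (a<p , nd , _) (here refl)                                         = ∈-lookup 1F (pack a)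
  pack-pb⊆ {a} (a<p , nd , _) (there (here refl))                                 = subst (_∈ pack a) (sym (pb-pb a a<p nd)) (∈-lookup 0F (pack a))
  pack-pb⊆ {a} (a<p , nd , _) (there (there (here refl)))                         = subst (_∈ pack a) (sym (pc-pb a a<p nd)) (∈-lookup 5F (pack a))
  pack-pb⊆ {a} (a<p , nd , _) (there (there (there (here refl))))                 = subst (_∈ pack a) (sym (pd-pb a a<p nd)) (∈-lookup 4F (pack a))
  pack-pb⊆ {a} (a<p , nd , _) (there (there (there (there (here refl)))))         = subst (_∈ pack a) (sym (pe-pb a a<p nd)) (∈-lookup 3F (pack a))
  pack-pb⊆ {a} (a<p , nd , _) (there (there (there (there (there (here refl)))))) = subst (_∈ pack a) (sym (pf-pb a a<p nd)) (∈-lookup 2F (pack a))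

  pack-pf⊆ : ∀ {a} → Generic a → pack (pf a) ⊆ pack a
  pack-pf⊆ {a} (a<p , nd , _) (here refl)                                         = ∈-lookup 5F (pack a)
  pack-pf⊆ {a} (a<p , nd , _) (there (here refl))                                 = subst (_∈ pack a) (sym (pb-pf a a<p nd)) (∈-lookup 4F (pack a))
  pack-pf⊆ {a} (a<p , nd , _) (there (there (here refl)))                         = subst (_∈ pack a) (sym (pc-pf a a<p nd)) (∈-lookup 3F (pack a))
  pack-pf⊆ {a} (a<p , nd , _) (there (there (there (here refl))))                 = subst (_∈ pack a) (sym (pd-pf a a<p nd)) (∈-lookup 2F (pack a))
  pack-pf⊆ {a} (a<p , nd , _) (there (there (there (there (here refl)))))         = subst (_∈ pack a) (sym (pe-pf a a<p nd)) (∈-lookup 1F (pack a))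
  pack-pf⊆ {a} (a<p , nd , _) (there (there (there (there (there (here refl)))))) = subst (_∈ pack a) (sym (pf-pf a a<p nd)) (∈-lookup 0F (pack a))

  data Reachable (a : ℕ) : ℕ → Set where
    start   : Reachable a a
    step-pb : ∀ {z} → Reachable a z → Reachable a (pb z)
    step-pf : ∀ {z} → Reachable a z → Reachable a (pf z)

  Reachable-trans : ∀ {a b c} → Reachable a b → Reachable b c → Reachable a c
  Reachable-trans r start       = r
  Reachable-trans r (step-pb s) = step-pb (Reachable-trans r s)
  Reachable-trans r (step-pf s) = step-pf (Reachable-trans r s)

  Reachable-Generic : ∀ {a z} → Generic a → Reachable a z → Generic z
  Reachable-Generic g start       = g
  Reachable-Generic g (step-pb r) = Generic-pb (Reachable-Generic g r)
  Reachable-Generic g (step-pf r) = Generic-pf (Reachable-Generic g r)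

  Reachable-⊆ : ∀ {a z} → Generic a → Reachable a z → pack z ⊆ pack a
  Reachable-⊆ g start       = λ w∈ → w∈
  Reachable-⊆ g (step-pb r) = ⊆-trans (pack-pb⊆ (Reachable-Generic g r)) (Reachable-⊆ g r)
  Reachable-⊆ g (step-pf r) = ⊆-trans (pack-pf⊆ (Reachable-Generic g r)) (Reachable-⊆ g r)

  -- pb and pf are involutions on generic residues.
  Reachable-sym : ∀ {a z} → Generic a → Reachable a z → Reachable z a
  Reachable-sym g start       = start
  Reachable-sym g (step-pb {z} r) with Reachable-Generic g r
  ... | z<p , nd , _ = Reachable-trans (subst (Reachable (pb z)) (pb-pb z z<p nd) (step-pb start)) (Reachable-sym g r)
  Reachable-sym g (step-pf {z} r) with Reachable-Generic g r
  ... | z<p , nd , _ = Reachable-trans (subst (Reachable (pf z)) (pf-pf z z<p nd) (step-pf start)) (Reachable-sym g r)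

  ∈pack⇒Reachable : ∀ {a z} → Generic a → z ∈ pack a → Reachable a z
  ∈pack⇒Reachable g (here refl)                                         = start
  ∈pack⇒Reachable g (there (here refl))                                 = step-pb start
  ∈pack⇒Reachable {a} (a<p , nd , _) (there (there (here refl)))        =
    subst (Reachable a) (pf-pb a a<p nd) (step-pf (step-pb start))
  ∈pack⇒Reachable {a} g@(a<p , nd , _) (there (there (there (here refl)))) =
    subst (Reachable a) (trans (pb-pf (pb a) b<p nd-b) (pe-pb a a<p nd)) (step-pb (step-pf (step-pb start)))
    where
    b<p : pb a ℕ.< p
    b<p = proj₁ (Generic-pb g)
    nd-b : Nondegenerate (pb a)
    nd-b = proj₁ (proj₂ (Generic-pb g))
  ∈pack⇒Reachable {a} (a<p , nd , _) (there (there (there (there (here refl))))) =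
    subst (Reachable a) (pb-pf a a<p nd) (step-pb (step-pf start))
  ∈pack⇒Reachable g (there (there (there (there (there (here refl)))))) = step-pf start

  ∈pack⇒Generic : ∀ {a z} → Generic a → z ∈ pack a → Generic z
  ∈pack⇒Generic g z∈ = Reachable-Generic g (∈pack⇒Reachable g z∈)

  ∈pack⇒⊆ : ∀ {a z} → Generic a → z ∈ pack a → pack z ⊆ pack a
  ∈pack⇒⊆ g z∈ = Reachable-⊆ g (∈pack⇒Reachable g z∈)

  ∈pack-sym : ∀ {a z} → Generic a → z ∈ pack a → a ∈ pack z
  ∈pack-sym g z∈ = Reachable-⊆ (∈pack⇒Generic g z∈) (Reachable-sym g (∈pack⇒Reachable g z∈)) (∈-lookup 0F _)

  module _ (a : ℕ) (nd : Nondegenerate a) where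
    private
      A : ℤ
      A = + a
      P∤A : ¬ P ∣ A
      P∤A = proj₁ nd
      P∤A+1 : ¬ P ∣ A + 1ℤ
      P∤A+1 = proj₂ nd
      cube : P ∣ A * A + A + 1ℤ → Special a
      cube = inj₁
      one : P ∣ A - 1ℤ → Special a
      one = inj₂ ∘ inj₁
      minus-two : P ∣ A - - + 2 → Special a
      minus-two = inj₂ ∘ inj₂ ∘ inj₁
      minus-half : P ∣ + 2 * A - - 1ℤ → Special a
      minus-half = inj₂ ∘ inj₂ ∘ inj₂
      at : ∀ {x y} (F : ℤ → ℤ) → x ≡ y → P ∣ F (+ y) → P ∣ F (+ x)
      at F x≡y = subst (λ t → P ∣ F (+ t)) (sym x≡y)

    a≡pb : a ≡ pb a → Special a
    a≡pb e = minus-half (∣-lincomb₁ 1ℤ (at (λ t → t - (- A - 1ℤ)) e (pb-cong a)) (identity A))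
      where
      identity : ∀ A → + 2 * A - - 1ℤ ≡ 1ℤ * (A - (- A - 1ℤ))
      identity = solve-∀

    a≡pc : a ≡ pc a → Special a
    a≡pc e = cube (∣-lincomb₁ 1ℤ (at (λ t → t * (A + 1ℤ) - - 1ℤ) e (pc-cong a nd)) (identity A))
      where
      identity : ∀ A → A * A + A + 1ℤ ≡ 1ℤ * (A * (A + 1ℤ) - - 1ℤ)
      identity = solve-∀

    a≡pd : a ≡ pd a → Special a
    a≡pd e = minus-two (∣-cancelˡ A _ P∤A (∣-lincomb₁ 1ℤ (at (λ t → t * (A + 1ℤ) - - A) e (pd-cong a nd)) (identity A)))
      where
      identity : ∀ A → A * (A - - + 2) ≡ 1ℤ * (A * (A + 1ℤ) - - A)
      identity = solve-∀

    a≡pe : a ≡ pe a → Special a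
    a≡pe e = cube (∣-lincomb₁ 1ℤ (at (λ t → t * A - - (A + 1ℤ)) e (pe-cong a nd)) (identity A))
      where
      identity : ∀ A → A * A + A + 1ℤ ≡ 1ℤ * (A * A - - (A + 1ℤ))
      identity = solve-∀

    a≡pf : a ≡ pf a → Special a
    a≡pf e = one (∣-cancelˡ (A + 1ℤ) _ P∤A+1 (∣-lincomb₁ 1ℤ (at (λ t → t * A - 1ℤ) e (pf-cong a nd)) (identity A)))
      where
      identity : ∀ A → (A + 1ℤ) * (A - 1ℤ) ≡ 1ℤ * (A * A - 1ℤ)
      identity = solve-∀

    pb≡pc : pb a ≡ pc a → Special a
    pb≡pc e = minus-two (∣-cancelˡ A _ P∤A (∣-lincomb₂ (A + 1ℤ) -1ℤ (pb-cong a) (at (λ t → t * (A + 1ℤ) - - 1ℤ) e (pc-cong a nd)) (identity A (+ pb a))))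
      where
      identity : ∀ A t → A * (A - - + 2) ≡ (A + 1ℤ) * (t - (- A - 1ℤ)) + -1ℤ * (t * (A + 1ℤ) - - 1ℤ)
      identity = solve-∀

    pb≡pd : pb a ≡ pd a → Special a
    pb≡pd e = cube (∣-lincomb₂ (A + 1ℤ) -1ℤ (pb-cong a) (at (λ t → t * (A + 1ℤ) - - A) e (pd-cong a nd)) (identity A (+ pb a)))
      where
      identity : ∀ A t → A * A + A + 1ℤ ≡ (A + 1ℤ) * (t - (- A - 1ℤ)) + -1ℤ * (t * (A + 1ℤ) - - A)
      identity = solve-∀

    pb≡pe : pb a ≡ pe a → Special a
    pb≡pe e = one (∣-cancelˡ (A + 1ℤ) _ P∤A+1 (∣-lincomb₂ A -1ℤ (pb-cong a) (at (λ t → t * A - - (A + 1ℤ)) e (pe-cong a nd)) (identity A (+ pb a))))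
      where
      identity : ∀ A t → (A + 1ℤ) * (A - 1ℤ) ≡ A * (t - (- A - 1ℤ)) + -1ℤ * (t * A - - (A + 1ℤ))
      identity = solve-∀

    pb≡pf : pb a ≡ pf a → Special a
    pb≡pf e = cube (∣-lincomb₂ A -1ℤ (pb-cong a) (at (λ t → t * A - 1ℤ) e (pf-cong a nd)) (identity A (+ pb a)))
      where
      identity : ∀ A t → A * A + A + 1ℤ ≡ A * (t - (- A - 1ℤ)) + -1ℤ * (t * A - 1ℤ)
      identity = solve-∀

    pc≡pd : pc a ≡ pd a → Special a
    pc≡pd e = one (∣-lincomb₂ -1ℤ 1ℤ (pc-cong a nd) (at (λ t → t * (A + 1ℤ) - - A) e (pd-cong a nd)) (identity A (+ pc a)))
      where
      identity : ∀ A t → A - 1ℤ ≡ -1ℤ * (t * (A + 1ℤ) - - 1ℤ) + 1ℤ * (t * (A + 1ℤ) - - A)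
      identity = solve-∀

    pc≡pe : pc a ≡ pe a → Special a
    pc≡pe e = cube (∣-lincomb₂ (- A) (A + 1ℤ) (pc-cong a nd) (at (λ t → t * A - - (A + 1ℤ)) e (pe-cong a nd)) (identity A (+ pc a)))
      where
      identity : ∀ A t → A * A + A + 1ℤ ≡ (- A) * (t * (A + 1ℤ) - - 1ℤ) + (A + 1ℤ) * (t * A - - (A + 1ℤ))
      identity = solve-∀

    -- Here c · (2a + 1) ≡ 0, and c ≢ 0 because c · a ≡ 1.
    pc≡pf : pc a ≡ pf a → Special a
    pc≡pf e = minus-half (∣-cancelˡ C _ P∤C (∣-lincomb₂ 1ℤ 1ℤ (pc-cong a nd) P∣CA-1 (identity₁ A C)))
      where
      C : ℤ
      C = + pc a
      P∣CA-1 : P ∣ C * A - 1ℤ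
      P∣CA-1 = at (λ t → t * A - 1ℤ) e (pf-cong a nd)
      identity₁ : ∀ A t → t * (+ 2 * A - - 1ℤ) ≡ 1ℤ * (t * (A + 1ℤ) - - 1ℤ) + 1ℤ * (t * A - 1ℤ)
      identity₁ = solve-∀
      identity₂ : ∀ A t → 1ℤ ≡ A * t + -1ℤ * (t * A - 1ℤ)
      identity₂ = solve-∀
      P∤C : ¬ P ∣ C
      P∤C P∣C = P∤1 (∣-lincomb₂ A -1ℤ P∣C P∣CA-1 (identity₂ A C))

    pd≡pe : pd a ≡ pe a → Special a
    pd≡pe e = minus-half (∣-lincomb₂ (- A) (A + 1ℤ) (pd-cong a nd) (at (λ t → t * A - - (A + 1ℤ)) e (pe-cong a nd)) (identity A (+ pd a)))
      where
      identity : ∀ A t → + 2 * A - - 1ℤ ≡ (- A) * (t * (A + 1ℤ) - - A) + (A + 1ℤ) * (t * A - - (A + 1ℤ))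
      identity = solve-∀

    pd≡pf : pd a ≡ pf a → Special a
    pd≡pf e = cube (∣-lincomb₂ A (- (A + 1ℤ)) (pd-cong a nd) (at (λ t → t * A - 1ℤ) e (pf-cong a nd)) (identity A (+ pd a)))
      where
      identity : ∀ A t → A * A + A + 1ℤ ≡ A * (t * (A + 1ℤ) - - A) + (- (A + 1ℤ)) * (t * A - 1ℤ)
      identity = solve-∀

    pe≡pf : pe a ≡ pf a → Special a
    pe≡pf e = minus-two (∣-lincomb₂ 1ℤ -1ℤ (pe-cong a nd) (at (λ t → t * A - 1ℤ) e (pf-cong a nd)) (identity A (+ pe a)))
      where
      identity : ∀ A t → A - - + 2 ≡ 1ℤ * (t * A - - (A + 1ℤ)) + -1ℤ * (t * A - 1ℤ)
      identity = solve-∀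

    pack-unique : ¬ Special a → Unique (pack a)
    pack-unique ¬special =
        (¬special ∘ a≡pb ∷ ¬special ∘ a≡pc ∷ ¬special ∘ a≡pd ∷ ¬special ∘ a≡pe ∷ ¬special ∘ a≡pf ∷ [])
      ∷ (¬special ∘ pb≡pc ∷ ¬special ∘ pb≡pd ∷ ¬special ∘ pb≡pe ∷ ¬special ∘ pb≡pf ∷ [])
      ∷ (¬special ∘ pc≡pd ∷ ¬special ∘ pc≡pe ∷ ¬special ∘ pc≡pf ∷ [])
      ∷ (¬special ∘ pd≡pe ∷ ¬special ∘ pd≡pf ∷ [])
      ∷ (¬special ∘ pe≡pf ∷ [])
      ∷ [] ∷ []

  -- The list of six-packs

  sixPack : ∀ {a} → Generic a → SixPack p (pack a)
  sixPack {a} g@(_ , nd , ¬special , _) =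
      (λ i → proj₁ (entry i))
    , lookup-injective (pack-unique a nd ¬special)
    , ∣⇒∣ᵤ (pb-cong a) , ∣⇒∣ᵤ (pc-cong a nd) , ∣⇒∣ᵤ (pd-cong a nd) , ∣⇒∣ᵤ (pe-cong a nd) , ∣⇒∣ᵤ (pf-cong a nd)
    , (λ i → Root⇒IsRoot (Vec.lookup (pack a) i) (proj₂ (proj₂ (proj₂ (entry i)))))
    where
    entry : ∀ i → Generic (Vec.lookup (pack a) i)
    entry i = ∈pack⇒Generic g (∈-lookup i (pack a))

  Canonical : ℕ → Set
  Canonical m = Generic m × All (m ℕ.≤_) (pack m)

  canonical-unique : ∀ {m m′ y} → Canonical m → Canonical m′ → y ∈ pack m → y ∈ pack m′ → m ≡ m′
  canonical-unique (gm , m≤) (gm′ , m′≤) y∈m y∈m′ =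
    ℕ.≤-antisym (AllV.lookup m≤ (∈pack⇒⊆ gm y∈m (∈pack-sym gm′ y∈m′)))
                (AllV.lookup m′≤ (∈pack⇒⊆ gm′ y∈m′ (∈pack-sym gm y∈m)))

  canonical-exists : ∀ {y} → Generic y → ∃[ m ] Canonical m × y ∈ pack m
  canonical-exists {y} gy = m , (gm , AllV.lookup⁻ (λ i → m≤ (∈pack⇒⊆ gy m∈ (∈-lookup i (pack m))))) , ∈pack-sym gy m∈
    where
    m : ℕ
    m = proj₁ (minimum (pack y))
    m∈ : m ∈ pack y
    m∈ = proj₁ (proj₂ (minimum (pack y)))
    m≤ : ∀ {w} → w ∈ pack y → m ℕ.≤ w
    m≤ = proj₂ (proj₂ (minimum (pack y)))
    gm : Generic m
    gm = ∈pack⇒Generic gy m∈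

  abstract
    special? : Decidable Special
    special? a = (P ∣? _) ⊎-dec ((P ∣? _) ⊎-dec ((P ∣? _) ⊎-dec (P ∣? _)))

    generic? : Decidable Generic
    generic? a = a ℕ.<? p ×-dec (¬? (P ∣? + a) ×-dec ¬? (P ∣? + a + 1ℤ)) ×-dec ¬? (special? a) ×-dec (P * P ∣? N (+ a))

    canonical? : Decidable Canonical
    canonical? m = generic? m ×-dec AllV.all? (m ℕ.≤?_) (pack m)

  representatives : List ℕ
  representatives = filter canonical? (upTo p)

  packs : List (Vec ℕ 6)
  packs = List.map pack representatives

  packs-sixPacks : All.All (SixPack p) packs
  packs-sixPacks = All.map⁺ (All.map (sixPack ∘ proj₁) (All.all-filter canonical? (upTo p)))

  packs-disjoint : AllPairs.AllPairs Disjoint packs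
  packs-disjoint = AllPairs.map⁺ (discharge (All.all-filter canonical? (upTo p))
    (AllPairs.filter⁺ canonical? {xs = upTo p} (AllPairs.map disjoint (Unique.upTo⁺ p))))
    where
    disjoint : ∀ {m m′} → m ≢ m′ → Canonical m → Canonical m′ → Disjoint (pack m) (pack m′)
    disjoint m≢m′ cm cm′ y y∈m y∈m′ = m≢m′ (canonical-unique cm cm′ y∈m y∈m′)
    discharge : ∀ {ms} → All.All Canonical ms →
      AllPairs.AllPairs (λ m m′ → Canonical m → Canonical m′ → Disjoint (pack m) (pack m′)) ms →
      AllPairs.AllPairs (λ m m′ → Disjoint (pack m) (pack m′)) ms
    discharge [] [] = []
    discharge (cm ∷ cms) (ds ∷ dss) = All.zipWith (λ (d , cm′) → d cm cm′) (ds , cms) ∷ discharge cms dss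

  Generic⇒InPacks : ∀ {y} → Generic y → InPacks packs y
  Generic⇒InPacks gy with canonical-exists gy
  ... | m , cm , y∈m = Any.map⁺ (lose (∈-filter⁺ canonical? (∈-upTo⁺ (proj₁ (proj₁ cm))) cm) y∈m)

  InPacks⇒Generic : ∀ {y} → InPacks packs y → Generic y
  InPacks⇒Generic y∈packs with find (Any.map⁻ y∈packs)
  ... | m , m∈reps , y∈m = ∈pack⇒Generic (proj₁ (proj₂ (∈-filter⁻ canonical? m∈reps))) y∈m

  -- Roots outside the six-packs

  classify : ∀ y → y ℕ.< p → Root (+ y) → (P ∣ + y ⊎ P ∣ + y + 1ℤ) ⊎ Special y ⊎ Generic y
  classify y y<p root with P ∣? + y | P ∣? + y + 1ℤ | special? y
  ... | yes P∣y | _          | _          = inj₁ (inj₁ P∣y)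
  ... | no _    | yes P∣y+1  | _          = inj₁ (inj₂ P∣y+1)
  ... | no _    | no _       | yes special = inj₂ (inj₁ special)
  ... | no P∤y  | no P∤y+1   | no ¬special = inj₂ (inj₂ (y<p , (P∤y , P∤y+1) , ¬special , root))

  Root0 : Root 0ℤ
  Root0 = divides 0ℤ (cong (λ z → z - 0ℤ ^ p - 1ℤ) (ℤ.^-zeroˡ p))

  Root-1 : Root -1ℤ
  Root-1 = Root-reflect 0ℤ -1ℤ (divides 0ℤ refl) Root0

  private
    fval-1 : fval p 1 ≡ (2 ℕ.^ p ℕ.∸ 2) ℕ./ p
    fval-1 = cong (ℕ._/ p) (trans (cong (λ z → 2 ℕ.^ p ℕ.∸ z ℕ.∸ 1) (ℕ.^-zeroˡ p)) (ℕ.∸-+-assoc (2 ℕ.^ p) 1 1))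

    p∣2ᵖ-2 : p ℕ∣.∣ 2 ℕ.^ p ℕ.∸ 2
    p∣2ᵖ-2 = ℕ∣.divides M (begin
      2 ℕ.^ p ℕ.∸ 2                     ≡⟨ cong (ℕ._∸ 2) (proj₂ (freshmansDream prime 1)) ⟩
      1 ℕ.^ p ℕ.+ (1 ℕ.+ p ℕ.* M) ℕ.∸ 2 ≡⟨ cong (λ z → z ℕ.+ (1 ℕ.+ p ℕ.* M) ℕ.∸ 2) (ℕ.^-zeroˡ p) ⟩
      p ℕ.* M                           ≡⟨ ℕ.*-comm p M ⟩
      M ℕ.* p                           ∎)
      where
      open ≡-Reasoning
      M : ℕ
      M = proj₁ (freshmansDream prime 1)

  Wieferich⇒Root1 : Wieferich p → Root 1ℤ
  Wieferich⇒Root1 w = IsRoot⇒Root 1 (subst (p ℕ∣.∣_) (sym fval-1) (ℕ∣.m*n∣o⇒m∣o/n p p w))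

  Root1⇒Wieferich : Root 1ℤ → Wieferich p
  Root1⇒Wieferich r = ℕ∣.m∣n/o⇒m*o∣n p∣2ᵖ-2 (subst (p ℕ∣.∣_) fval-1 (Root⇒IsRoot 1 r))

  OrbitOfOne⇒[Root⇒Root1] : ∀ y → OrbitOfOne y → Root (+ y) → Root 1ℤ
  OrbitOfOne⇒[Root⇒Root1] y (inj₁ P∣y-1) r = Root-cong 1ℤ (+ y) (∣-lincomb₁ -1ℤ P∣y-1 (identity (+ y))) r
    where
    identity : ∀ y → 1ℤ - y ≡ -1ℤ * (y - 1ℤ)
    identity = solve-∀
  OrbitOfOne⇒[Root⇒Root1] y (inj₂ (inj₁ P∣y+2)) r = Root-reflect (+ y) 1ℤ (∣-lincomb₁ 1ℤ P∣y+2 (identity (+ y))) r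
    where
    identity : ∀ y → 1ℤ - (- y - 1ℤ) ≡ 1ℤ * (y - - + 2)
    identity = solve-∀
  OrbitOfOne⇒[Root⇒Root1] y (inj₂ (inj₂ P∣2y+1)) r =
    Root-reflect (- + 2) 1ℤ (divides 0ℤ refl) (Root-invert (+ y) (- + 2) (∣-lincomb₁ -1ℤ P∣2y+1 (identity (+ y))) r)
    where
    identity : ∀ y → y * - + 2 - 1ℤ ≡ -1ℤ * (+ 2 * y - - 1ℤ)
    identity = solve-∀

  OrbitOfOne⇒[Root1⇒Root] : ∀ y → OrbitOfOne y → Root 1ℤ → Root (+ y)
  OrbitOfOne⇒[Root1⇒Root] y (inj₁ P∣y-1) r = Root-cong (+ y) 1ℤ P∣y-1 r
  OrbitOfOne⇒[Root1⇒Root] y (inj₂ (inj₁ P∣y+2)) r = Root-reflect 1ℤ (+ y) (∣-lincomb₁ 1ℤ P∣y+2 (identity (+ y))) r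
    where
    identity : ∀ y → y - (- 1ℤ - 1ℤ) ≡ 1ℤ * (y - - + 2)
    identity = solve-∀
  OrbitOfOne⇒[Root1⇒Root] y (inj₂ (inj₂ P∣2y+1)) r =
    Root-invert (- + 2) (+ y) (∣-lincomb₁ -1ℤ P∣2y+1 (identity (+ y))) (Root-reflect 1ℤ (- + 2) (divides 0ℤ refl) r)
    where
    identity : ∀ y → - + 2 * y - 1ℤ ≡ -1ℤ * (+ 2 * y - - 1ℤ)
    identity = solve-∀

  OrbitOfOne⇔InW : ∀ y → OrbitOfOne y ⇔ InW p y
  OrbitOfOne⇔InW y = mk⇔ (Sum.map ∣⇒∣ᵤ (Sum.map ∣⇒∣ᵤ ∣⇒∣ᵤ)) (Sum.map ∣ᵤ⇒∣ (Sum.map ∣ᵤ⇒∣ ∣ᵤ⇒∣))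

  module _ (S : ℕ → Set)
           (S⇒Root : ∀ y → S y → Root (+ y))
           (S-covers : ∀ y → Root (+ y) → (P ∣ + y ⊎ P ∣ + y + 1ℤ) ⊎ PrimitiveCubeRoot y → S y)
           (Generic⇒¬S : ∀ y → Generic y → ¬ S y) where

    private
      packs-avoid-S : All.All (λ v → ∀ y → y ∈ v → ¬ S y) packs
      packs-avoid-S = All.tabulate (λ v∈packs y y∈v → Generic⇒¬S y (InPacks⇒Generic (lose v∈packs y∈v)))

      InPacks⇒IsRoot : ∀ y → InPacks packs y → IsRoot p y
      InPacks⇒IsRoot y y∈packs = Root⇒IsRoot y (proj₂ (proj₂ (proj₂ (InPacks⇒Generic y∈packs))))

      sortNonWieferich : ¬ Wieferich p → ∀ y → Root (+ y) →
        (P ∣ + y ⊎ P ∣ + y + 1ℤ) ⊎ Special y ⊎ Generic y → S y ⊎ InPacks packs y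
      sortNonWieferich ¬w y root (inj₁ degenerate)          = inj₁ (S-covers y root (inj₁ degenerate))
      sortNonWieferich ¬w y root (inj₂ (inj₁ (inj₁ cube)))  = inj₁ (S-covers y root (inj₂ cube))
      sortNonWieferich ¬w y root (inj₂ (inj₁ (inj₂ orbit))) = ⊥-elim (¬w (Root1⇒Wieferich (OrbitOfOne⇒[Root⇒Root1] y orbit root)))
      sortNonWieferich ¬w y root (inj₂ (inj₂ generic))      = inj₂ (Generic⇒InPacks generic)

      sortWieferich : ∀ y → Root (+ y) →
        (P ∣ + y ⊎ P ∣ + y + 1ℤ) ⊎ Special y ⊎ Generic y → S y ⊎ InW p y ⊎ InPacks packs y
      sortWieferich y root (inj₁ degenerate)          = inj₁ (S-covers y root (inj₁ degenerate))
      sortWieferich y root (inj₂ (inj₁ (inj₁ cube)))  = inj₁ (S-covers y root (inj₂ cube))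
      sortWieferich y root (inj₂ (inj₁ (inj₂ orbit))) = inj₂ (inj₁ (Equivalence.to (OrbitOfOne⇔InW y) orbit))
      sortWieferich y root (inj₂ (inj₂ generic))      = inj₂ (inj₂ (Generic⇒InPacks generic))

    rootShape : RootShape p S
    rootShape = nonWieferich , wieferich
      where
      nonWieferich : ¬ Wieferich p → NonWiefShape p S
      nonWieferich ¬w = packs , packs-sixPacks , packs-disjoint , packs-avoid-S , λ y y<p →
          (λ isRoot → sortNonWieferich ¬w y (IsRoot⇒Root y isRoot) (classify y y<p (IsRoot⇒Root y isRoot)))
        , [ Root⇒IsRoot y ∘ S⇒Root y , InPacks⇒IsRoot y ]′

      wieferich : Wieferich p → WiefShape p S
      wieferich w = packs , packs-sixPacks , packs-disjoint , λ y y<p →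
          (λ isRoot → sortWieferich y (IsRoot⇒Root y isRoot) (classify y y<p (IsRoot⇒Root y isRoot)))
        , [ Root⇒IsRoot y ∘ S⇒Root y
          , [ (λ orbit → Root⇒IsRoot y (OrbitOfOne⇒[Root1⇒Root] y (Equivalence.from (OrbitOfOne⇔InW y) orbit) (Wieferich⇒Root1 w)))
            , InPacks⇒IsRoot y ]′ ]′

  private
    ZeroOrMinusOne : ℕ → Set
    ZeroOrMinusOne y = (+ y ≋ + 0 [ p ]) ⊎ (+ y ≋ - + 1 [ p ])

    ZeroOrMinusOne⇒Root : ∀ y → ZeroOrMinusOne y → Root (+ y)
    ZeroOrMinusOne⇒Root y (inj₁ y≡0) = Root-cong (+ y) 0ℤ (∣ᵤ⇒∣ y≡0) Root0
    ZeroOrMinusOne⇒Root y (inj₂ y≡-1) = Root-cong (+ y) -1ℤ (∣ᵤ⇒∣ y≡-1) Root-1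

    degenerate⇒ZeroOrMinusOne : ∀ y → P ∣ + y ⊎ P ∣ + y + 1ℤ → ZeroOrMinusOne y
    degenerate⇒ZeroOrMinusOne y (inj₁ P∣y)   = inj₁ (∣⇒∣ᵤ (∣-lincomb₁ 1ℤ P∣y (identity₁ (+ y))))
      where
      identity₁ : ∀ y → y - 0ℤ ≡ 1ℤ * y
      identity₁ = solve-∀
    degenerate⇒ZeroOrMinusOne y (inj₂ P∣y+1) = inj₂ (∣⇒∣ᵤ (∣-lincomb₁ 1ℤ P∣y+1 (identity₂ (+ y))))
      where
      identity₂ : ∀ y → y - -1ℤ ≡ 1ℤ * (y + 1ℤ)
      identity₂ = solve-∀

    Generic⇒¬ZeroOrMinusOne : ∀ y → Generic y → ¬ ZeroOrMinusOne y
    Generic⇒¬ZeroOrMinusOne y (_ , (P∤y , P∤y+1) , _) = [ P∤y ∘ via identity₁ , P∤y+1 ∘ via identity₂ ]′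
      where
      via : ∀ {e e′} → e′ ≡ 1ℤ * e → + p ℤD.∣ e → P ∣ e′
      via identity P∣e = ∣-lincomb₁ 1ℤ (∣ᵤ⇒∣ P∣e) identity
      identity₁ : + y ≡ 1ℤ * (+ y - + 0)
      identity₁ = sym (trans (ℤ.*-identityˡ _) (ℤ.+-identityʳ (+ y)))
      identity₂ : + y + 1ℤ ≡ 1ℤ * (+ y - - + 1)
      identity₂ = sym (ℤ.*-identityˡ _)

  rootShape-p≡5[6] : ∀ k → n ≡ suc (3 ℕ.* k) → RootShape p ZeroOrMinusOne
  rootShape-p≡5[6] k n≡1+3k = rootShape ZeroOrMinusOne ZeroOrMinusOne⇒Root
    (λ { y _ (inj₁ degenerate) → degenerate⇒ZeroOrMinusOne y degenerate ; y _ (inj₂ cube) → ⊥-elim (no-cube y cube) })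
    Generic⇒¬ZeroOrMinusOne
    where
    p∤3 : ¬ p ℕ∣.∣ 3
    p∤3 = subst (λ m → ¬ suc m ℕ∣.∣ 3) (sym n≡1+3k) (2+3k∤3 k)
      where
      2+3k∤3 : ∀ k → ¬ suc (suc (3 ℕ.* k)) ℕ∣.∣ 3
      2+3k∤3 zero    (ℕ∣.divides (suc (suc q)) ())
      2+3k∤3 (suc k) 5+3k∣3 = ℕ.<⇒≱ (ℕ.≤-trans (ℕ.n≤1+n 4) (ℕ.+-monoʳ-≤ 2 (ℕ.*-monoʳ-≤ 3 (ℕ.s≤s ℕ.z≤n)))) (ℕ∣.∣⇒≤ 5+3k∣3)

    -- y³ ≡ 1 and Fermat give y² ≡ y^(3k+2) ≡ y, so y ≡ 0 or y ≡ 1; neither is a root of y² + y + 1 as p ≠ 3.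
    no-cube : ∀ y → ¬ PrimitiveCubeRoot y
    no-cube y cube = [ P∤y , P∤y-1 ]′ (euclidsLemmaℤ Y (Y - 1ℤ) P∣Y[Y-1])
      where
      Y : ℤ
      Y = + y
      P∣Y[Y-1] : P ∣ Y * (Y - 1ℤ)
      P∣Y[Y-1] = ∣-lincomb₂ 1ℤ (- (Y * Y)) P∣Yᵖ-Y (∣w³-1⇒∣w³ᵏ-1 Y k P∣Y³-1) (identity₁ Y (Y ^ (3 ℕ.* k)))
        where
        identity₁ : ∀ Y X → Y * (Y - 1ℤ) ≡ 1ℤ * (Y * (Y * X) - Y) + (- (Y * Y)) * (X - 1ℤ)
        identity₁ = solve-∀
        identity₂ : ∀ Y → Y * Y * Y - 1ℤ ≡ (Y - 1ℤ) * (Y * Y + Y + 1ℤ)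
        identity₂ = solve-∀
        P∣Y³-1 : P ∣ Y * Y * Y - 1ℤ
        P∣Y³-1 = ∣-lincomb₁ (Y - 1ℤ) cube (identity₂ Y)
        P∣Yᵖ-Y : P ∣ Y ^ suc (suc (3 ℕ.* k)) - Y
        P∣Yᵖ-Y = subst (λ m → P ∣ Y ^ suc m - Y) n≡1+3k (fermat y)
      P∤y : ¬ P ∣ Y
      P∤y P∣y = P∤1 (∣-lincomb₂ 1ℤ (- (Y + 1ℤ)) cube P∣y (identity Y))
        where
        identity : ∀ Y → 1ℤ ≡ 1ℤ * (Y * Y + Y + 1ℤ) + (- (Y + 1ℤ)) * Y
        identity = solve-∀
      P∤y-1 : ¬ P ∣ Y - 1ℤ
      P∤y-1 P∣y-1 = p∤3 (∣⇒∣ᵤ (∣-lincomb₂ 1ℤ (- (Y + + 2)) cube P∣y-1 (identity Y)))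
        where
        identity : ∀ Y → + 3 ≡ 1ℤ * (Y * Y + Y + 1ℤ) + (- (Y + + 2)) * (Y - 1ℤ)
        identity = solve-∀

  module _ (k : ℕ) (n≡3k : n ≡ 3 ℕ.* k) (ζ ζ′ : ℕ) (ζ³≡1 : + (ζ ℕ.^ 3) ≋ + 1 [ p ]) (ζ≢1 : ¬ (+ ζ ≋ + 1 [ p ]))
           (ζζ′≡1 : + ζ * + ζ′ ≋ + 1 [ p ]) where
    private
      Z Z′ : ℤ
      Z = + ζ
      Z′ = + ζ′

      P∣Z³-1 : P ∣ Z * Z * Z - 1ℤ
      P∣Z³-1 = ∣-lincomb₁ 1ℤ (subst (λ u → P ∣ u - 1ℤ) (pos-^ ζ 3) (∣ᵤ⇒∣ ζ³≡1)) (identity Z)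
        where
        identity : ∀ Z → Z * Z * Z - 1ℤ ≡ 1ℤ * (Z * (Z * (Z * 1ℤ)) - 1ℤ)
        identity = solve-∀

      P∤Z-1 : ¬ P ∣ Z - 1ℤ
      P∤Z-1 = ζ≢1 ∘ ∣⇒∣ᵤ

      P∣ZZ′-1 : P ∣ Z * Z′ - 1ℤ
      P∣ZZ′-1 = ∣ᵤ⇒∣ ζζ′≡1

      cube-ζ : PrimitiveCubeRoot ζ
      cube-ζ = ∣-cancelˡ (Z - 1ℤ) _ P∤Z-1 (∣-lincomb₁ 1ℤ P∣Z³-1 (identity Z))
        where
        identity : ∀ Z → (Z - 1ℤ) * (Z * Z + Z + 1ℤ) ≡ 1ℤ * (Z * Z * Z - 1ℤ)
        identity = solve-∀

      cube-ζ′ : PrimitiveCubeRoot ζ′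
      cube-ζ′ = ∣-cancelˡ (Z * Z) _ P∤Z² (∣-lincomb₂ 1ℤ (Z * Z′ + 1ℤ + Z) cube-ζ P∣ZZ′-1 (identity₁ Z Z′))
        where
        identity₁ : ∀ Z Z′ → Z * Z * (Z′ * Z′ + Z′ + 1ℤ) ≡ 1ℤ * (Z * Z + Z + 1ℤ) + (Z * Z′ + 1ℤ + Z) * (Z * Z′ - 1ℤ)
        identity₁ = solve-∀
        identity₂ : ∀ Z → 1ℤ ≡ -1ℤ * (Z * Z * Z - 1ℤ) + (Z * Z) * Z
        identity₂ = solve-∀
        P∤Z : ¬ P ∣ Z
        P∤Z P∣Z = P∤1 (∣-lincomb₂ -1ℤ (Z * Z) P∣Z³-1 P∣Z (identity₂ Z))
        P∤Z² : ¬ P ∣ Z * Z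
        P∤Z² P∣Z² = [ P∤Z , P∤Z ]′ (euclidsLemmaℤ Z Z P∣Z²)

      S : ℕ → Set
      S y = (+ y ≋ + 0 [ p ]) ⊎ (+ y ≋ - + 1 [ p ]) ⊎ (+ y ≋ + ζ [ p ]) ⊎ (+ y ≋ + ζ′ [ p ])

      S⇒Root : ∀ y → S y → Root (+ y)
      S⇒Root y (inj₁ y≡0)              = ZeroOrMinusOne⇒Root y (inj₁ y≡0)
      S⇒Root y (inj₂ (inj₁ y≡-1))      = ZeroOrMinusOne⇒Root y (inj₂ y≡-1)
      S⇒Root y (inj₂ (inj₂ (inj₁ y≡ζ))) = Root-cong (+ y) Z (∣ᵤ⇒∣ y≡ζ) Root-ζ
        where
        Root-ζ : Root Z
        Root-ζ = primitiveCubeRoot⇒Root k n≡3k ζ P∣Z³-1 P∤Z-1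
      S⇒Root y (inj₂ (inj₂ (inj₂ y≡ζ′))) = Root-cong (+ y) Z′ (∣ᵤ⇒∣ y≡ζ′) Root-ζ′
        where
        Root-ζ′ : Root Z′
        Root-ζ′ = Root-invert Z Z′ P∣ZZ′-1 (primitiveCubeRoot⇒Root k n≡3k ζ P∣Z³-1 P∤Z-1)

      -- (y - ζ)(y - ζ′) ≡ y² + y + 1 modulo p.
      S-covers : ∀ y → Root (+ y) → (P ∣ + y ⊎ P ∣ + y + 1ℤ) ⊎ PrimitiveCubeRoot y → S y
      S-covers y _ (inj₁ degenerate) = Sum.map₂ inj₁ (degenerate⇒ZeroOrMinusOne y degenerate)
      S-covers y _ (inj₂ cube) = inj₂ (inj₂ (Sum.map ∣⇒∣ᵤ ∣⇒∣ᵤ (euclidsLemmaℤ (+ y - Z) (+ y - Z′)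
        (∣-lincomb₃ 1ℤ (- (+ y * Z′)) (+ y * (Z + 1ℤ) + 1ℤ) cube cube-ζ P∣ZZ′-1 (identity (+ y) Z Z′)))))
        where
        identity : ∀ Y Z Z′ → (Y - Z) * (Y - Z′)
          ≡ 1ℤ * (Y * Y + Y + 1ℤ) + (- (Y * Z′)) * (Z * Z + Z + 1ℤ) + (Y * (Z + 1ℤ) + 1ℤ) * (Z * Z′ - 1ℤ)
        identity = solve-∀

      Generic⇒¬S : ∀ y → Generic y → ¬ S y
      Generic⇒¬S y g (inj₁ y≡0)                  = Generic⇒¬ZeroOrMinusOne y g (inj₁ y≡0)
      Generic⇒¬S y g (inj₂ (inj₁ y≡-1))          = Generic⇒¬ZeroOrMinusOne y g (inj₂ y≡-1)
      Generic⇒¬S y g (inj₂ (inj₂ (inj₁ y≡ζ)))    = proj₁ (proj₂ (proj₂ g)) (inj₁ (PrimitiveCubeRoot-cong y Z (∣ᵤ⇒∣ y≡ζ) cube-ζ))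
      Generic⇒¬S y g (inj₂ (inj₂ (inj₂ y≡ζ′)))   = proj₁ (proj₂ (proj₂ g)) (inj₁ (PrimitiveCubeRoot-cong y Z′ (∣ᵤ⇒∣ y≡ζ′) cube-ζ′))

    rootShape-p≡1[6] : RootShape p S
    rootShape-p≡1[6] = rootShape S S⇒Root S-covers Generic⇒¬S


open import Data.Empty using (⊥-elim)
open import Data.Integer as ℤ using (+_; -_)
open import Data.Nat using (ℕ; _*_; _^_; _%_; _<_)
open import Data.Nat.Primality using (¬prime[0])
open import Data.Nat.Properties using (suc-injective)
open import Data.Nat.DivMod using (_/_; m≡m%n+[m/n]*n)
open import Data.Nat.Tactic.RingSolver using (solve-∀)
open import Data.Product using (_×_; _,_)
open import Data.Sum using (_⊎_)
open import Defs
open import Relation.Binary.PropositionalEquality using (cong; trans)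
open import Relation.Nullary using (¬_)

proposition5p3 : (p : ℕ) → Prime p → (p % 6 ≡ 1 ⊎ p % 6 ≡ 5) →
    ((p % 6 ≡ 1) → (ζ ζ' : ℕ) → ζ < p → ζ' < p →
       ((+ (ζ ^ 3)) ≋ + 1 [ p ]) → ¬ ((+ ζ) ≋ + 1 [ p ]) →
       ((+ ζ) ℤ.* (+ ζ') ≋ + 1 [ p ]) →
       RootShape p (λ y → ((+ y) ≋ + 0 [ p ]) ⊎ ((+ y) ≋ - + 1 [ p ])
                        ⊎ ((+ y) ≋ + ζ [ p ]) ⊎ ((+ y) ≋ + ζ' [ p ])))
  × ((p % 6 ≡ 5) →
       RootShape p (λ y → ((+ y) ≋ + 0 [ p ]) ⊎ ((+ y) ≋ - + 1 [ p ])))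
proposition5p3 ℕ.zero    isPrime _ = ⊥-elim (¬prime[0] isPrime)
proposition5p3 (suc n) isPrime _ =
    (λ p%6≡1 ζ ζ′ _ _ → OddPrime.rootShape-p≡1[6] n isPrime
       (q * 3) (trans (n≡r+6q p%6≡1) (6q≡3q+3q q)) (q * 2) (trans (n≡r+6q p%6≡1) (6q≡3[2q] q)) ζ ζ′)
  , (λ p%6≡5 → OddPrime.rootShape-p≡5[6] n isPrime
       (2 ℕ.+ q * 3) (trans (n≡r+6q p%6≡5) (4+6q≡2[2+3q] q)) (1 ℕ.+ q * 2) (trans (n≡r+6q p%6≡5) (4+6q≡1+3[1+2q] q)))
  where
  q : ℕ
  q = suc n / 6
  n≡r+6q : ∀ {r} → suc n % 6 ≡ suc r → n ≡ r ℕ.+ q * 6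
  n≡r+6q p%6≡1+r = suc-injective (trans (m≡m%n+[m/n]*n (suc n) 6) (cong (ℕ._+ q * 6) p%6≡1+r))
  6q≡3q+3q : ∀ q → 0 ℕ.+ q * 6 ≡ q * 3 ℕ.+ q * 3
  6q≡3q+3q = solve-∀
  6q≡3[2q] : ∀ q → 0 ℕ.+ q * 6 ≡ 3 * (q * 2)
  6q≡3[2q] = solve-∀
  4+6q≡2[2+3q] : ∀ q → 4 ℕ.+ q * 6 ≡ (2 ℕ.+ q * 3) ℕ.+ (2 ℕ.+ q * 3)
  4+6q≡2[2+3q] = solve-∀
  4+6q≡1+3[1+2q] : ∀ q → 4 ℕ.+ q * 6 ≡ suc (3 * (1 ℕ.+ q * 2))
  4+6q≡1+3[1+2q] = solve-∀
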